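{- Let $k \geq 3$ and $m \geq 2$ be integers and let $n = m(k+1)$. Let $G_{n,k}$ be the graph constructed as follows: (1) take $m$ vertex-disjoint copies $K^1_{k+1}, K^2_{k+1}, \ldots, K^m_{k+1}$ of the complete graph $K_{k+1}$; (2) delete one edge from $K^1_{k+1}$, calling its endpoints $a_1$ and $v_1$, and delete one edge from $K^m_{k+1}$, calling its endpoints $b_m$ and $v_m$; (3) for each $j = 2, \ldots, m-1$, delete two edges of $K^j_{k+1}$ that share a common endpoint, calling the common endpoint $v_j$ and the other endpoints of the two deleted edges $a_j$ and $b_j$; (4) add the edges $(v_i, v_{i+1})$ and $(a_i, b_{i+1})$ for every $i = 1, \ldots, m-1$. Then $G_{n,k}$ is a $k$-regular graph on $n$ vertices, and its number of Hamiltonian cycles is $$h(n,k) = (k-1)^2\left[(k-2)!\right]^{\frac{n}{k+1}}.$$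
   Context: A Hamiltonian cycle of a graph on $n$ vertices is a simple cycle of length $n$ (a cycle passing through every vertex exactly once), counted as an undirected cycle, i.e. as a subgraph, so that a cycle and its reversal (and its rotations) count once. -}

module Defs where

open import Data.Nat using (ℕ; zero; suc; _+_; _*_; _∸_; _^_; _≤_; _<_)
open import Data.Fin using (Fin; toℕ; remQuot)
open import Data.Bool using (Bool; true)
open import Data.Product using (Σ; ∃; _×_; _,_; proj₁; proj₂)
open import Data.Sum using (_⊎_)
open import Data.List using (List; length)
open import Data.List.Relation.Unary.Unique.Propositional using (Unique)
open import Data.List.Membership.Propositional using (_∈_)
open import Data.Vec using (Vec; lookup)
open import Function using (_⇔_)
open import Function.Definitions using (Injective)
open import Relation.Binary.PropositionalEquality using (_≡_; _≢_)
open import Relation.Nullary using (¬_)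

HasSize : {A : Set} → (A → Set) → ℕ → Set
HasSize {A} P c = Σ (List A) λ L → Unique L × (∀ x → (x ∈ L) ⇔ P x) × (length L ≡ c)

UPair : ∀ {p} → Fin p → Fin p → ℕ → ℕ → Set
UPair x y a b = (toℕ x ≡ a × toℕ y ≡ b) ⊎ (toℕ x ≡ b × toℕ y ≡ a)

-- Vertex u : Fin (m * suc k) is the pair
-- (block i, position x) = remQuot (suc k) u, block i ∈ {0..m-1} is the copy
-- K^{i+1}_{k+1}.  Inside each block: position 0 = v, 1 = a, 2 = b.
module G (k m : ℕ) where

  n : ℕ
  n = m * suc k

  V : Set
  V = Fin n

  block : V → Fin m
  block u = proj₁ (remQuot {m} (suc k) u)

  pos : V → Fin (suc k)
  pos u = proj₂ (remQuot {m} (suc k) u)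

  -- edge {v,a} is deleted in blocks 1..m-1 (1-indexed), i.e. 0-indexed i < m-1
  -- edge {v,b} is deleted in blocks 2..m,   i.e. 0-indexed 0 < i
  Deleted : Fin m → Fin (suc k) → Fin (suc k) → Set
  Deleted i x y = (UPair x y 0 1 × suc (toℕ i) < m) ⊎ (UPair x y 0 2 × 0 < toℕ i)

  Adj : V → V → Set
  Adj u w =
      (block u ≡ block w × pos u ≢ pos w × ¬ Deleted (block u) (pos u) (pos w))
    ⊎ Cross u w ⊎ Cross w u
    where
      Cross : V → V → Set
      Cross s t = toℕ (block t) ≡ suc (toℕ (block s))
                × ((toℕ (pos s) ≡ 0 × toℕ (pos t) ≡ 0) ⊎ (toℕ (pos s) ≡ 1 × toℕ (pos t) ≡ 2))

  Regular : ℕ → Set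
  Regular d = ∀ u → HasSize (Adj u) d

  Next : Fin n → Fin n → Set
  Next t s = (toℕ s ≡ suc (toℕ t)) ⊎ (suc (toℕ t) ≡ n × toℕ s ≡ 0)

  Subgraph : Set
  Subgraph = Vec (Vec Bool n) n

  IsHamCycle : Subgraph → Set
  IsHamCycle H = Σ (Fin n → V) λ σ →
      Injective _≡_ _≡_ σ
    × (∀ t s → Next t s → Adj (σ t) (σ s))
    × (∀ u w → (lookup (lookup H u) w ≡ true) ⇔
                 (∃ λ t → ∃ λ s → Next t s × ((σ t ≡ u × σ s ≡ w) ⊎ (σ t ≡ w × σ s ≡ u))))

-- Number the blocks 0, …, m − 1; positions 0, 1, 2 of a block are its vertices v, a, b.  The only
-- edges between the blocks ≤ j and the blocks > j are v_j v_{j+1} and a_j b_{j+1}, so a Hamiltonian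
-- cycle uses both of them for every j.  Cut at v₀ v₁, the cycle is therefore the path
--   v₀ X₀ a₀ b₁ X₁ a₁ b₂ ⋯ a_{m−2} b_{m−1} X_{m−1} v_{m−1} v_{m−2} ⋯ v₁,
-- where X₀ orders the k − 1 vertices of block 0 other than v₀, a₀, each X_j with 0 < j < m − 1 orders
-- the k − 2 vertices of block j at positions ≥ 3, and X_{m−1} orders the k − 1 vertices of the last
-- block other than b, v; conversely every such choice is a Hamiltonian cycle.  Hence there are
-- (k − 1)! · ((k − 2)!)^{m−2} · (k − 1)! of them.  Regularity: every deleted edge at a vertex is
-- matched by exactly one added edge at it.

module Submission where

open import Defs
open import Data.Bool using (Bool; true; false)
open import Data.Empty using (⊥-elim)
open import Data.Fin using (Fin; zero; suc; toℕ; fromℕ; fromℕ<; inject₁; punchOut; combine)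
open import Data.Fin.Properties
  using (toℕ-injective; toℕ-fromℕ; toℕ-fromℕ<; toℕ<n; any?; punchOut-injective; injective⇒≤;
         combine-remQuot; remQuot-combine; combine-injective)
  renaming (_≟_ to _≟ᶠ_; suc-injective to sucᶠ-injective)
open import Data.List using (List; []; _∷_; _++_; [_]; length; map; reverse; take; drop; tabulate; allFin; cartesianProduct)
open import Data.List.Properties
  using (++-assoc; ++-identityʳ; length-++; length-map; length-tabulate; length-take; take++drop≡id;
         reverse-++; reverse-involutive; unfold-reverse; ∷-injective; ∷-injectiveˡ; ∷-injectiveʳ; ∷ʳ-injectiveˡ; ∷ʳ-injectiveʳ)
open import Data.List.Membership.Propositional using (_∈_; _∉_)
open import Data.List.Membership.Propositional.Properties
  using (∈-++⁺ˡ; ∈-++⁺ʳ; ∈-++⁻; ∈-∃++; ∈-map⁺; ∈-map⁻; ∈-tabulate⁺; ∈-allFin; ∈-cartesianProduct⁺; ∈-cartesianProduct⁻)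
open import Data.List.Relation.Unary.All as All using (All; []; _∷_)
import Data.List.Relation.Unary.All.Properties as All
open import Data.List.Relation.Unary.AllPairs using ([]; _∷_)
open import Data.List.Relation.Unary.Any using (here; there)
import Data.List.Relation.Unary.Any.Properties as Any
open import Data.List.Relation.Unary.Unique.Propositional using (Unique)
import Data.List.Relation.Unary.Unique.Propositional.Properties as Unique
open import Data.Nat using (ℕ; zero; suc; _+_; _*_; _^_; _∸_; _≤_; _<_; z≤n; s≤s; _≟_; _≤?_; _<?_; pred; _!; >-nonZero)
open import Data.Nat.Properties
open import Data.Nat.Solver using (module +-*-Solver)
open import Data.Product using (∃; ∃₂; _×_; _,_; proj₁; proj₂)
open import Data.Sum using (_⊎_; inj₁; inj₂)
import Data.Sum as Sum
open import Data.Unit using (⊤; tt)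
open import Data.Vec using (Vec)
import Data.Vec as Vec
import Data.Vec.Properties as Vec
open import Function using (_⇔_; mk⇔; Equivalence; _∘_; case_of_)
import Function.Properties.Equivalence as ⇔
open import Relation.Binary.PropositionalEquality hiding ([_])
open import Relation.Nullary using (¬_; Dec; yes; no; does)
open import Relation.Nullary.Decidable using (_×-dec_; _⊎-dec_)
open import Relation.Unary using (Decidable)

open Equivalence using (to; from)

module _ {A : Set} where

  Unique-∷⁺ : ∀ {x : A} {xs} → x ∉ xs → Unique xs → Unique (x ∷ xs)
  Unique-∷⁺ {xs = xs} x∉xs u = All.tabulate (λ y∈xs x≡y → x∉xs (subst (_∈ xs) (sym x≡y) y∈xs)) ∷ u

  Unique-++⁻ˡ : ∀ (xs : List A) {ys} → Unique (xs ++ ys) → Unique xs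
  Unique-++⁻ˡ []       u       = []
  Unique-++⁻ˡ (x ∷ xs) (h ∷ u) = All.++⁻ˡ xs h ∷ Unique-++⁻ˡ xs u

  Unique-++⁻ʳ : ∀ (xs : List A) {ys} → Unique (xs ++ ys) → Unique ys
  Unique-++⁻ʳ []       u       = u
  Unique-++⁻ʳ (x ∷ xs) (h ∷ u) = Unique-++⁻ʳ xs u

  Unique-++⇒disjoint : ∀ (xs : List A) {ys x} → Unique (xs ++ ys) → x ∈ xs → x ∉ ys
  Unique-++⇒disjoint (_ ∷ xs) (h ∷ u) (here refl) x∈ys = All.lookup h (∈-++⁺ʳ xs x∈ys) refl
  Unique-++⇒disjoint (_ ∷ xs) (h ∷ u) (there x∈xs) = Unique-++⇒disjoint xs u x∈xs

  Unique-++⁺ : ∀ {xs ys : List A} → Unique xs → Unique ys → (∀ {x} → x ∈ xs → x ∉ ys) → Unique (xs ++ ys)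
  Unique-++⁺ uxs uys disj = Unique.++⁺ uxs uys (λ (p , q) → disj p q)

  Unique-swap : ∀ (xs : List A) {ys} → Unique (xs ++ ys) → Unique (ys ++ xs)
  Unique-swap xs u = Unique-++⁺ (Unique-++⁻ʳ xs u) (Unique-++⁻ˡ xs u)
    (λ y∈ys y∈xs → Unique-++⇒disjoint xs u y∈xs y∈ys)

  Unique-reverse : ∀ {xs : List A} → Unique xs → Unique (reverse xs)
  Unique-reverse {[]}     u = []
  Unique-reverse {x ∷ xs} u@(_ ∷ uxs) = subst Unique (sym (unfold-reverse x xs))
    (Unique-++⁺ (Unique-reverse uxs) ([] ∷ [])
      (λ { y∈ (here refl) → Unique.Unique[x∷xs]⇒x∉xs u (Any.reverse⁻ y∈) }))

  ∈-insert : ∀ (xs ys : List A) {x y} → y ∈ xs ++ ys → y ∈ xs ++ x ∷ ys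
  ∈-insert xs ys y∈ with ∈-++⁻ xs y∈
  ... | inj₁ p = ∈-++⁺ˡ p
  ... | inj₂ q = ∈-++⁺ʳ xs (there q)

  ∈-delete : ∀ (xs ys : List A) {x y} → y ∈ xs ++ x ∷ ys → y ≡ x ⊎ y ∈ xs ++ ys
  ∈-delete xs ys y∈ with ∈-++⁻ xs y∈
  ... | inj₁ p         = inj₂ (∈-++⁺ˡ p)
  ... | inj₂ (here eq) = inj₁ eq
  ... | inj₂ (there q) = inj₂ (∈-++⁺ʳ xs q)

  Unique-delete : ∀ (xs ys : List A) {x} → Unique (xs ++ x ∷ ys) → Unique (xs ++ ys)
  Unique-delete []       ys (h ∷ u) = u
  Unique-delete (_ ∷ xs) ys (h ∷ u) =
    All.tabulate (λ y∈ → All.lookup h (∈-insert xs ys y∈)) ∷ Unique-delete xs ys u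

  Unique⇒∉-delete : ∀ (xs ys : List A) {x} → Unique (xs ++ x ∷ ys) → x ∉ xs ++ ys
  Unique⇒∉-delete xs ys u x∈ with ∈-++⁻ xs x∈
  ... | inj₁ p = Unique-++⇒disjoint xs u p (here refl)
  ... | inj₂ q = Unique.Unique[x∷xs]⇒x∉xs (Unique-++⁻ʳ xs u) q

  Unique-split-unique : ∀ (xs ys xs′ ys′ : List A) {x} → Unique (xs ++ x ∷ ys) →
                 xs ++ x ∷ ys ≡ xs′ ++ x ∷ ys′ → xs ≡ xs′ × ys ≡ ys′
  Unique-split-unique []       ys []        ys′ u eq = refl , ∷-injectiveʳ eq
  Unique-split-unique []       ys (_ ∷ xs′) ys′ (h ∷ u) eq with ∷-injective eq
  ... | refl , eq′ = ⊥-elim (All.lookup h (subst (_ ∈_) (sym eq′) (∈-++⁺ʳ xs′ (here refl))) refl)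
  Unique-split-unique (_ ∷ xs) ys []        ys′ (h ∷ u) eq with ∷-injective eq
  ... | refl , eq′ = ⊥-elim (All.lookup h (∈-++⁺ʳ xs (here refl)) refl)
  Unique-split-unique (_ ∷ xs) ys (_ ∷ xs′) ys′ (h ∷ u) eq with ∷-injective eq
  ... | refl , eq′ with Unique-split-unique xs ys xs′ ys′ u eq′
  ...   | refl , refl = refl , refl

  ∈-five-parts : ∀ {b p v z : A} X Z → z ∈ b ∷ X ++ p ∷ Z ++ [ v ] → z ≡ b ⊎ z ∈ X ⊎ z ≡ p ⊎ z ∈ Z ⊎ z ≡ v
  ∈-five-parts X Z (here eq) = inj₁ eq
  ∈-five-parts X Z (there z∈) with ∈-++⁻ X z∈
  ... | inj₁ z∈X = inj₂ (inj₁ z∈X)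
  ... | inj₂ (here eq) = inj₂ (inj₂ (inj₁ eq))
  ... | inj₂ (there z∈′) with ∈-++⁻ Z z∈′
  ...   | inj₁ z∈Z = inj₂ (inj₂ (inj₂ (inj₁ z∈Z)))
  ...   | inj₂ (here eq) = inj₂ (inj₂ (inj₂ (inj₂ eq)))

  ∈-four-parts : ∀ {h p z : A} X Y → z ∈ h ∷ X ++ p ∷ Y → z ≡ h ⊎ z ∈ X ⊎ z ≡ p ⊎ z ∈ Y
  ∈-four-parts X Y (here eq) = inj₁ eq
  ∈-four-parts X Y (there z∈) with ∈-++⁻ X z∈
  ... | inj₁ z∈X = inj₂ (inj₁ z∈X)
  ... | inj₂ (here eq) = inj₂ (inj₂ (inj₁ eq))
  ... | inj₂ (there z∈Y) = inj₂ (inj₂ (inj₂ z∈Y))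

  ∷⇒∷ʳ : ∀ (x : A) xs → ∃₂ λ ys y → x ∷ xs ≡ ys ++ [ y ]
  ∷⇒∷ʳ x []       = [] , x , refl
  ∷⇒∷ʳ x (y ∷ xs) with ∷⇒∷ʳ y xs
  ... | ys , z , eq = x ∷ ys , z , cong (x ∷_) eq

  ∷ʳ-suffix : ∀ (xs : List A) y ys zs {u} → xs ++ y ∷ ys ≡ zs ++ [ u ] → ∃ λ ys₀ → y ∷ ys ≡ ys₀ ++ [ u ]
  ∷ʳ-suffix []       y ys zs eq = zs , eq
  ∷ʳ-suffix (x ∷ xs) y ys []       eq with ∷-injective eq
  ... | _ , eq′ = ⊥-elim (nonempty xs eq′)
    where
      nonempty : ∀ xs {y ys} → xs ++ y ∷ ys ≢ []
      nonempty [] ()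
      nonempty (_ ∷ _) ()
  ∷ʳ-suffix (x ∷ xs) y ys (z ∷ zs) eq = ∷ʳ-suffix xs y ys zs (∷-injectiveʳ eq)

  last∈suffix : ∀ (xs ys : List A) {v y zs} → xs ++ [ v ] ≡ ys ++ y ∷ zs → v ∈ y ∷ zs
  last∈suffix xs ys {v} eq with ∷ʳ-suffix ys _ _ xs (sym eq)
  ... | ys₀ , eq′ = subst (v ∈_) (sym eq′) (∈-++⁺ʳ ys₀ (here refl))

  ++-cancel-length : ∀ (xs xs′ : List A) {ys ys′} → length xs ≡ length xs′ → xs ++ ys ≡ xs′ ++ ys′ →
                     xs ≡ xs′ × ys ≡ ys′
  ++-cancel-length []       []        _   eq = refl , eq
  ++-cancel-length (x ∷ xs) (x′ ∷ xs′) len eq with ∷-injective eq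
  ... | refl , eq′ with ++-cancel-length xs xs′ (suc-injective len) eq′
  ...   | refl , refl = refl , refl

  first-failure : ∀ {P : A → Set} → Decidable P → ∀ (x : A) xs → P x → ¬ All P (x ∷ xs) →
                  ∃₂ λ ys p → ∃₂ λ y zs → x ∷ xs ≡ ys ++ p ∷ y ∷ zs × All P (ys ++ [ p ]) × ¬ P y
  first-failure P? x []       px ¬all = ⊥-elim (¬all (px ∷ []))
  first-failure P? x (y ∷ xs) px ¬all with P? y
  ... | no ¬py = [] , x , y , xs , refl , px ∷ [] , ¬py
  ... | yes py with first-failure P? y xs py (¬all ∘ (px ∷_))
  ...   | ys , p , z , zs , eq , all , ¬pz = x ∷ ys , p , z , zs , cong (x ∷_) eq , px ∷ all , ¬pz

  Consecutive : List A → A → A → Set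
  Consecutive xs u w = ∃₂ λ ys zs → xs ≡ ys ++ u ∷ w ∷ zs

  Junction : List A → List A → A → A → Set
  Junction xs ys u w = ∃₂ λ xs₀ ys₀ → xs ≡ xs₀ ++ [ u ] × ys ≡ w ∷ ys₀

  WrapsAround : List A → A → A → Set
  WrapsAround xs u w = ∃ λ ys → xs ≡ w ∷ ys ++ [ u ]

  CyclicSucc : List A → A → A → Set
  CyclicSucc xs u w = Consecutive xs u w ⊎ WrapsAround xs u w

  CyclicEdge : List A → A → A → Set
  CyclicEdge xs u w = CyclicSucc xs u w ⊎ CyclicSucc xs w u

  consecutive-∈ : ∀ {xs u w} → Consecutive xs u w → u ∈ xs × w ∈ xs
  consecutive-∈ (ys , zs , refl) = ∈-++⁺ʳ ys (here refl) , ∈-++⁺ʳ ys (there (here refl))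

  consecutive-++⁺ˡ : ∀ {xs} ys {u w} → Consecutive xs u w → Consecutive (xs ++ ys) u w
  consecutive-++⁺ˡ ys {u} {w} (xs₀ , zs , refl) = xs₀ , zs ++ ys , ++-assoc xs₀ (u ∷ w ∷ zs) ys

  consecutive-++⁺ʳ : ∀ xs {ys u w} → Consecutive ys u w → Consecutive (xs ++ ys) u w
  consecutive-++⁺ʳ xs {u = u} {w} (ys₀ , zs , refl) = xs ++ ys₀ , zs , sym (++-assoc xs ys₀ (u ∷ w ∷ zs))

  junction⇒consecutive : ∀ {xs ys u w} → Junction xs ys u w → Consecutive (xs ++ ys) u w
  junction⇒consecutive {u = u} {w} (xs₀ , ys₀ , refl , refl) = xs₀ , ys₀ , ++-assoc xs₀ [ u ] (w ∷ ys₀)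

  junction-∷ʳ : ∀ xs {a b : A} {ys u w} → Junction (xs ++ [ a ]) (b ∷ ys) u w → u ≡ a × w ≡ b
  junction-∷ʳ xs (xs₀ , ys₀ , eq₁ , eq₂) = sym (∷ʳ-injectiveʳ xs xs₀ eq₁) , sym (∷-injectiveˡ eq₂)

  consecutive-++⁻ : ∀ (xs ys zs ws : List A) {u w} → xs ++ ys ≡ zs ++ u ∷ w ∷ ws →
                    Consecutive xs u w ⊎ Consecutive ys u w ⊎ Junction xs ys u w
  consecutive-++⁻ []          ys zs ws eq = inj₂ (inj₁ (zs , ws , eq))
  consecutive-++⁻ (x ∷ [])    ys [] ws eq with ∷-injective eq
  ... | refl , eq′ = inj₂ (inj₂ ([] , ws , refl , eq′))
  consecutive-++⁻ (x ∷ y ∷ xs) ys [] ws eq with ∷-injective eq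
  ... | refl , eq′ with ∷-injective eq′
  ...   | refl , _ = inj₁ ([] , xs , refl)
  consecutive-++⁻ (x ∷ xs) ys (z ∷ zs) ws eq with ∷-injective eq
  ... | refl , eq′ with consecutive-++⁻ xs ys zs ws eq′
  ...   | inj₁ (xs₀ , xs₁ , e)                  = inj₁ (x ∷ xs₀ , xs₁ , cong (x ∷_) e)
  ...   | inj₂ (inj₁ c)                         = inj₂ (inj₁ c)
  ...   | inj₂ (inj₂ (xs₀ , ys₀ , e₁ , e₂))      = inj₂ (inj₂ (x ∷ xs₀ , ys₀ , cong (x ∷_) e₁ , e₂))

  Unique⇒consecutive-≢ : ∀ {xs u w} → Unique xs → Consecutive xs u w → u ≢ w
  Unique⇒consecutive-≢ {u = u} uxs (ys , zs , refl) refl =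
    Unique.Unique[x∷xs]⇒x∉xs (Unique-++⁻ʳ ys uxs) (here refl)

  Unique⇒consecutive-head : ∀ {x : A} {xs w} → Unique (x ∷ xs) → Consecutive (x ∷ xs) x w →
                            ∃ λ ys → xs ≡ w ∷ ys
  Unique⇒consecutive-head {xs = xs} {w} u (ys , zs , eq) with Unique-split-unique [] xs ys (w ∷ zs) u eq
  ... | refl , eq′ = zs , eq′

  Unique⇒¬consecutive-last : ∀ {xs} {v w : A} → Unique (xs ++ [ v ]) → ¬ Consecutive (xs ++ [ v ]) v w
  Unique⇒¬consecutive-last {xs} u (ys , zs , eq) with Unique-split-unique xs [] ys (_ ∷ zs) u eq
  ... | _ , ()

  Unique⇒ends-¬consecutive : ∀ {x y : A} {xs u w} → Unique (x ∷ xs ++ [ y ]) → xs ≢ [] →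
    Consecutive (x ∷ xs ++ [ y ]) u w → ¬ ((u ≡ x × w ≡ y) ⊎ (u ≡ y × w ≡ x))
  Unique⇒ends-¬consecutive {x} {y} {xs} uL xs≢[] c (inj₁ (refl , refl)) with Unique⇒consecutive-head uL c
  ... | ys , eq = xs≢[] (proj₁ (Unique-split-unique xs [] [] ys (Unique-++⁻ʳ [ x ] uL) eq))
  Unique⇒ends-¬consecutive {xs = xs} uL _ c (inj₂ (refl , refl)) = Unique⇒¬consecutive-last {xs = _ ∷ xs} uL c

  private
    wrapsAround-++⁻ : ∀ a xs b ys {u w} → WrapsAround ((a ∷ xs) ++ (b ∷ ys)) u w → Junction (b ∷ ys) (a ∷ xs) u w
    wrapsAround-++⁻ a xs b ys (zs , eq) with ∷-injective eq
    ... | refl , eq′ with ∷ʳ-suffix xs b ys zs eq′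
    ...   | ys₀ , e = ys₀ , xs , e , refl

    junction⇒wrapsAround : ∀ {xs ys u w} → Junction ys xs u w → WrapsAround (xs ++ ys) u w
    junction⇒wrapsAround {u = u} {w} (ys₀ , xs₀ , refl , refl) = xs₀ ++ ys₀ , cong (w ∷_) (sym (++-assoc xs₀ ys₀ [ u ]))

    cyclicSucc-rotate : ∀ xs ys {u w} → CyclicSucc (xs ++ ys) u w → CyclicSucc (ys ++ xs) u w
    cyclicSucc-rotate []       ys s rewrite ++-identityʳ ys = s
    cyclicSucc-rotate (x ∷ xs) [] s rewrite ++-identityʳ (x ∷ xs) = s
    cyclicSucc-rotate (x ∷ xs) (y ∷ ys) (inj₁ (zs , ws , eq)) with consecutive-++⁻ (x ∷ xs) (y ∷ ys) zs ws eq
    ... | inj₁ c        = inj₁ (consecutive-++⁺ʳ (y ∷ ys) c)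
    ... | inj₂ (inj₁ c) = inj₁ (consecutive-++⁺ˡ (x ∷ xs) c)
    ... | inj₂ (inj₂ j) = inj₂ (junction⇒wrapsAround j)
    cyclicSucc-rotate (x ∷ xs) (y ∷ ys) (inj₂ w) = inj₁ (junction⇒consecutive (wrapsAround-++⁻ x xs y ys w))

    cyclicSucc-reverse : ∀ {xs u w} → CyclicSucc xs u w → CyclicSucc (reverse xs) w u
    cyclicSucc-reverse {u = u} {w} (inj₁ (ys , zs , refl)) = inj₁ (reverse zs , reverse ys , (begin
      reverse (ys ++ u ∷ w ∷ zs)                     ≡⟨ reverse-++ ys (u ∷ w ∷ zs) ⟩
      reverse (u ∷ w ∷ zs) ++ reverse ys             ≡⟨ cong (_++ reverse ys) (begin
        reverse (u ∷ w ∷ zs)                           ≡⟨ unfold-reverse u (w ∷ zs) ⟩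
        reverse (w ∷ zs) ++ [ u ]                      ≡⟨ cong (_++ [ u ]) (unfold-reverse w zs) ⟩
        (reverse zs ++ [ w ]) ++ [ u ]                 ≡⟨ ++-assoc (reverse zs) [ w ] [ u ] ⟩
        reverse zs ++ w ∷ u ∷ []                       ∎) ⟩
      (reverse zs ++ w ∷ u ∷ []) ++ reverse ys       ≡⟨ ++-assoc (reverse zs) (w ∷ u ∷ []) (reverse ys) ⟩
      reverse zs ++ w ∷ u ∷ reverse ys               ∎))
      where open ≡-Reasoning
    cyclicSucc-reverse {u = u} {w} (inj₂ (ys , refl)) = inj₂ (reverse ys , (begin
      reverse (w ∷ ys ++ [ u ])        ≡⟨ unfold-reverse w (ys ++ [ u ]) ⟩
      reverse (ys ++ [ u ]) ++ [ w ]   ≡⟨ cong (_++ [ w ]) (reverse-++ ys [ u ]) ⟩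
      u ∷ reverse ys ++ [ w ]          ∎))
      where open ≡-Reasoning

  cyclicEdge-rotate : ∀ xs ys {u w} → CyclicEdge (xs ++ ys) u w → CyclicEdge (ys ++ xs) u w
  cyclicEdge-rotate xs ys (inj₁ s) = inj₁ (cyclicSucc-rotate xs ys s)
  cyclicEdge-rotate xs ys (inj₂ s) = inj₂ (cyclicSucc-rotate xs ys s)

  cyclicEdge-reverse : ∀ {xs u w} → CyclicEdge xs u w → CyclicEdge (reverse xs) u w
  cyclicEdge-reverse (inj₁ s) = inj₂ (cyclicSucc-reverse s)
  cyclicEdge-reverse (inj₂ s) = inj₁ (cyclicSucc-reverse s)

  cyclicEdge-reverse⁻ : ∀ {xs u w} → CyclicEdge (reverse xs) u w → CyclicEdge xs u w
  cyclicEdge-reverse⁻ {xs} e = subst (λ ys → CyclicEdge ys _ _) (reverse-involutive xs) (cyclicEdge-reverse e)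

  cyclicEdges-⊆⇒≡ : ∀ {x y : A} {M M′} → Unique (x ∷ M ++ [ y ]) → Unique (x ∷ M′ ++ [ y ]) → M ≢ [] →
    (∀ {u w} → CyclicEdge (x ∷ M ++ [ y ]) u w → CyclicEdge (x ∷ M′ ++ [ y ]) u w) → x ∷ M ++ [ y ] ≡ x ∷ M′ ++ [ y ]
  cyclicEdges-⊆⇒≡ {x} {y} {M} {M′} uL uL′ M≢[] ⊆ = go [] x (M ++ [ y ]) (M′ ++ [ y ]) refl refl
    where
      L L′ : List A
      L = x ∷ M ++ [ y ]
      L′ = x ∷ M′ ++ [ y ]
      -- Walk along the common prefix: the successor of z in L is a neighbour of z in L′ other than
      -- its predecessor, hence its successor.
      go : ∀ P z R R′ → L ≡ P ++ z ∷ R → L′ ≡ P ++ z ∷ R′ → L ≡ L′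
      go P z []       []         eq eq′ = trans eq (sym eq′)
      go P z []       (r ∷ R′)   eq eq′ with ∷ʳ-injectiveʳ P (x ∷ M) (sym eq)
      ... | refl with Unique-split-unique P (r ∷ R′) (x ∷ M′) [] (subst Unique eq′ uL′) (sym eq′)
      ...   | _ , ()
      go P z (r ∷ R) []          eq eq′ with ∷ʳ-injectiveʳ P (x ∷ M′) (sym eq′)
      ... | refl with Unique-split-unique P (r ∷ R) (x ∷ M) [] (subst Unique eq uL) (sym eq)
      ...   | _ , ()
      go P z (r ∷ R) (r′ ∷ R′)   eq eq′ with ⊆ (inj₁ (inj₁ (P , R , eq)))
      ... | inj₁ (inj₁ (X , Y , e)) with Unique-split-unique X (r ∷ Y) P (r′ ∷ R′) (subst Unique e uL′) (trans (sym e) eq′)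
      ...   | _ , e₂ with ∷-injectiveˡ e₂
      ...     | refl = go (P ++ [ z ]) r R R′ (trans eq (sym (++-assoc P [ z ] (r ∷ R))))
                                           (trans eq′ (sym (++-assoc P [ z ] (r ∷ R′))))
      go P z (r ∷ R) (r′ ∷ R′)   eq eq′ | inj₂ (inj₁ (X , Y , e))
        with Unique-split-unique (X ++ [ r ]) Y P (r′ ∷ R′) (subst Unique e″ uL′) (trans (sym e″) eq′)
        where
          e″ : L′ ≡ (X ++ [ r ]) ++ z ∷ Y
          e″ = trans e (sym (++-assoc X [ r ] (z ∷ Y)))
      ... | refl , _ = ⊥-elim (Unique-++⇒disjoint (X ++ [ r ]) (subst Unique eq uL) (∈-++⁺ʳ X (here refl)) (there (here refl)))
      go P z (r ∷ R) (r′ ∷ R′)   eq eq′ | inj₁ (inj₂ (C , e))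
        with Unique-split-unique (r ∷ C) [] P (r′ ∷ R′) (subst Unique e uL′) (trans (sym e) eq′)
      ... | _ , ()
      go P z (r ∷ R) (r′ ∷ R′)   eq eq′ | inj₂ (inj₂ (C , e)) with ∷-injective e
      ... | refl , e₂ with ∷ʳ-injectiveʳ C M′ (sym e₂)
      ...   | refl with Unique-split-unique P (r ∷ R) [] (M ++ [ y ]) (subst Unique eq uL) (sym eq)
      ...     | refl , e₃ with Unique-split-unique [] R M [] (subst Unique (sym e₃) (Unique-++⁻ʳ [ x ] uL)) e₃
      ...       | M≡[] , _ = ⊥-elim (M≢[] (sym M≡[]))

‖_‖ : ∀ {Q : Set} → Dec Q → ℕ
‖ yes _ ‖ = 1
‖ no _ ‖  = 0

‖‖≤1 : ∀ {Q : Set} (Q? : Dec Q) → ‖ Q? ‖ ≤ 1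
‖‖≤1 (yes _) = s≤s z≤n
‖‖≤1 (no _)  = z≤n

module _ {A : Set} where

  Enumeration : (A → Set) → List A → Set
  Enumeration P xs = Unique xs × (∀ x → x ∈ xs ⇔ P x)

  Enumeration-⇔ : ∀ {P Q : A → Set} {xs} → (∀ x → P x ⇔ Q x) → Enumeration P xs → Enumeration Q xs
  Enumeration-⇔ P⇔Q (u , iff) = u , λ x → ⇔.trans (iff x) (P⇔Q x)

  HasSize-⇔ : ∀ {P Q : A → Set} {c} → HasSize P c → (∀ x → P x ⇔ Q x) → HasSize Q c
  HasSize-⇔ (xs , u , iff , len) P⇔Q = xs , u , (λ x → ⇔.trans (iff x) (P⇔Q x)) , len

  HasSize-⊎ : ∀ {P Q : A → Set} {a b} → HasSize P a → HasSize Q b → (∀ x → P x → ¬ Q x) →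
              HasSize (λ x → P x ⊎ Q x) (a + b)
  HasSize-⊎ (xs , uxs , iff , refl) (ys , uys , iff′ , refl) disj =
    xs ++ ys , Unique-++⁺ uxs uys (λ p q → disj _ (to (iff _) p) (to (iff′ _) q)) ,
    (λ x → mk⇔ (Sum.map (to (iff x)) (to (iff′ x)) ∘ ∈-++⁻ xs)
               (Sum.[ ∈-++⁺ˡ ∘ from (iff x) , ∈-++⁺ʳ xs ∘ from (iff′ x) ])) ,
    length-++ xs

  HasSize-dec : ∀ {Q : Set} {P : A → Set} (Q? : Dec Q) →
                (Q → ∃ λ a → ∀ x → P x ⇔ x ≡ a) → (¬ Q → ∀ x → ¬ P x) → HasSize P ‖ Q? ‖
  HasSize-dec (yes q) single _ =
    let (a , P⇔) = single q in
    [ a ] , [] ∷ [] , (λ x → mk⇔ (λ { (here eq) → from (P⇔ x) eq ; (there ()) }) (here ∘ to (P⇔ x))) , refl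
  HasSize-dec (no ¬q) _ empty = [] , [] , (λ x → mk⇔ (λ ()) (⊥-elim ∘ empty ¬q x)) , refl

  HasSize-singleton : ∀ (a : A) → HasSize (_≡ a) 1
  HasSize-singleton a = HasSize-dec (yes tt) (λ _ → a , λ _ → ⇔.refl) (λ ¬⊤ → ⊥-elim (¬⊤ tt))

  HasSize-remove : ∀ {P : A → Set} {c} (a : A) → HasSize P c → P a → HasSize (λ x → P x × x ≢ a) (c ∸ 1)
  HasSize-remove {P} a (zs , u , iff , refl) pa with ∈-∃++ (from (iff a) pa)
  ... | xs , ys , refl = xs ++ ys , Unique-delete xs ys u , (λ x → mk⇔ (to′ x) (from′ x)) ,
        cong (_∸ 1) (sym (begin
          length (xs ++ a ∷ ys)        ≡⟨ length-++ xs ⟩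
          length xs + suc (length ys)  ≡⟨ +-suc (length xs) (length ys) ⟩
          suc (length xs + length ys)  ≡⟨ cong suc (length-++ xs) ⟨
          suc (length (xs ++ ys))      ∎))
    where
      open ≡-Reasoning
      to′ : ∀ x → x ∈ xs ++ ys → P x × x ≢ a
      to′ x x∈ with ∈-++⁻ xs x∈
      ... | inj₁ p = to (iff x) (∈-++⁺ˡ p) , λ { refl → Unique-++⇒disjoint xs u p (here refl) }
      ... | inj₂ q = to (iff x) (∈-++⁺ʳ xs (there q)) ,
                     λ { refl → Unique.Unique[x∷xs]⇒x∉xs (Unique-++⁻ʳ xs u) q }
      from′ : ∀ x → P x × x ≢ a → x ∈ xs ++ ys
      from′ x (px , x≢a) with ∈-++⁻ xs (from (iff x) px)
      ... | inj₁ p         = ∈-++⁺ˡ p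
      ... | inj₂ (here eq) = ⊥-elim (x≢a eq)
      ... | inj₂ (there q) = ∈-++⁺ʳ xs q

  enumeration-split : ∀ {x xs ys} → Unique (x ∷ xs) → Enumeration (_∈ x ∷ xs) ys →
                      ∃₂ λ zs ws → ys ≡ zs ++ x ∷ ws × Enumeration (_∈ xs) (zs ++ ws)
  enumeration-split {x} {xs} ux (uys , iff) with ∈-∃++ (from (iff x) (here refl))
  ... | zs , ws , refl = zs , ws , refl , Unique-delete zs ws uys , λ y → mk⇔ (to′ y) (from′ y)
    where
      to′ : ∀ y → y ∈ zs ++ ws → y ∈ xs
      to′ y p with to (iff y) (∈-insert zs ws p)
      ... | here refl = ⊥-elim (Unique⇒∉-delete zs ws uys p)
      ... | there q   = q
      from′ : ∀ y → y ∈ xs → y ∈ zs ++ ws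
      from′ y p with ∈-delete zs ws (from (iff y) (there p))
      ... | inj₁ refl = ⊥-elim (Unique.Unique[x∷xs]⇒x∉xs ux p)
      ... | inj₂ q    = q

  enumeration-length : ∀ {xs ys} → Unique xs → Enumeration (_∈ xs) ys → length ys ≡ length xs
  enumeration-length {[]} {[]} _ _ = refl
  enumeration-length {[]} {y ∷ ys} _ (_ , iff) with to (iff y) (here refl)
  ... | ()
  enumeration-length {x ∷ xs} ux@(_ ∷ uxs) e with enumeration-split ux e
  ... | zs , ws , refl , e′ = begin
    length (zs ++ x ∷ ws)          ≡⟨ length-++ zs ⟩
    length zs + suc (length ws)    ≡⟨ +-suc (length zs) (length ws) ⟩
    suc (length zs + length ws)    ≡⟨ cong suc (length-++ zs) ⟨
    suc (length (zs ++ ws))        ≡⟨ cong suc (enumeration-length uxs e′) ⟩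
    suc (length xs)                ∎
    where open ≡-Reasoning

  insertAt : ℕ → A → List A → List A
  insertAt i x zs = take i zs ++ x ∷ drop i zs

  enumeration-insert : ∀ {x xs zs} i → x ∉ xs → Enumeration (_∈ xs) zs → Enumeration (_∈ x ∷ xs) (insertAt i x zs)
  enumeration-insert {x} {xs} {zs} i x∉xs (uzs , iff) =
    Unique-++⁺ (Unique.take⁺ i uzs) (Unique-∷⁺ (x∉xs ∘ ∈zs ∘ ∈-drop) (Unique.drop⁺ i uzs)) disjoint ,
    λ y → mk⇔ (to′ y) (from′ y)
    where
      split : take i zs ++ drop i zs ≡ zs
      split = take++drop≡id i zs
      ∈zs : ∀ {y} → y ∈ zs → y ∈ xs
      ∈zs {y} = to (iff y)
      ∈-take : ∀ {y} → y ∈ take i zs → y ∈ zs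
      ∈-take p = subst (_ ∈_) split (∈-++⁺ˡ p)
      ∈-drop : ∀ {y} → y ∈ drop i zs → y ∈ zs
      ∈-drop p = subst (_ ∈_) split (∈-++⁺ʳ (take i zs) p)
      disjoint : ∀ {y} → y ∈ take i zs → y ∉ x ∷ drop i zs
      disjoint p (here refl) = x∉xs (∈zs (∈-take p))
      disjoint p (there q)   = Unique-++⇒disjoint (take i zs) (subst Unique (sym split) uzs) p q
      to′ : ∀ y → y ∈ insertAt i x zs → y ∈ x ∷ xs
      to′ y p with ∈-delete (take i zs) (drop i zs) p
      ... | inj₁ eq = here eq
      ... | inj₂ q  = there (∈zs (subst (_ ∈_) split q))
      from′ : ∀ y → y ∈ x ∷ xs → y ∈ insertAt i x zs
      from′ y (here refl) = ∈-++⁺ʳ (take i zs) (here refl)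
      from′ y (there q)   = ∈-insert (take i zs) (drop i zs) (subst (_ ∈_) (sym split) (from (iff y) q))

module _ {A B : Set} where

  Unique-map⁺ : ∀ (f : A → B) {xs} → Unique xs → (∀ {x y} → x ∈ xs → y ∈ xs → f x ≡ f y → x ≡ y) →
                Unique (map f xs)
  Unique-map⁺ f []       _ = []
  Unique-map⁺ f (h ∷ u) inj =
    All.tabulate (λ z∈ fx≡z → let (y , y∈ , z≡fy) = ∈-map⁻ f z∈ in
                   All.lookup h y∈ (inj (here refl) (there y∈) (trans fx≡z z≡fy)))
    ∷ Unique-map⁺ f u (λ p q → inj (there p) (there q))

  HasSize-map : ∀ {P : A → Set} {Q : B → Set} {c} (f : A → B) → HasSize P c →
                (∀ {x y} → P x → P y → f x ≡ f y → x ≡ y) →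
                (∀ y → Q y ⇔ (∃ λ x → P x × f x ≡ y)) → HasSize Q c
  HasSize-map f (xs , u , iff , refl) inj Q⇔ =
    map f xs ,
    Unique-map⁺ f u (λ p q → inj (to (iff _) p) (to (iff _) q)) ,
    (λ y → mk⇔ (λ y∈ → let (x , x∈ , eq) = ∈-map⁻ f y∈ in from (Q⇔ y) (x , to (iff x) x∈ , sym eq))
               (λ qy → let (x , px , eq) = to (Q⇔ y) qy in subst (_∈ map f xs) eq (∈-map⁺ f (from (iff x) px)))) ,
    length-map f xs

  length-cartesianProduct : ∀ (xs : List A) (ys : List B) → length (cartesianProduct xs ys) ≡ length xs * length ys
  length-cartesianProduct []       ys = refl
  length-cartesianProduct (x ∷ xs) ys =
    trans (length-++ (map (x ,_) ys)) (cong₂ _+_ (length-map (x ,_) ys) (length-cartesianProduct xs ys))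

  HasSize-× : ∀ {P : A → Set} {Q : B → Set} {a b} → HasSize P a → HasSize Q b →
              HasSize (λ (z : A × B) → P (proj₁ z) × Q (proj₂ z)) (a * b)
  HasSize-× (xs , uxs , iff , refl) (ys , uys , iff′ , refl) =
    cartesianProduct xs ys , Unique.cartesianProduct⁺ uxs uys ,
    (λ (x , y) → mk⇔ (λ p → let (p₁ , p₂) = ∈-cartesianProduct⁻ xs ys p in to (iff x) p₁ , to (iff′ y) p₂)
                     (λ (px , qy) → ∈-cartesianProduct⁺ (from (iff x) px) (from (iff′ y) qy))) ,
    length-cartesianProduct xs ys

module _ {A B C : Set} where

  HasSize-map₂ : ∀ {P : A → Set} {Q : B → Set} {R : C → Set} {a b} (f : A → B → C) →
                 HasSize P a → HasSize Q b →
                 (∀ {x y x′ y′} → P x → Q y → P x′ → Q y′ → f x y ≡ f x′ y′ → x ≡ x′ × y ≡ y′) →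
                 (∀ z → R z ⇔ (∃₂ λ x y → P x × Q y × f x y ≡ z)) → HasSize R (a * b)
  HasSize-map₂ f hP hQ inj R⇔ =
    HasSize-map (λ (x , y) → f x y) (HasSize-× hP hQ)
      (λ (px , qy) (px′ , qy′) eq → let (eq₁ , eq₂) = inj px qy px′ qy′ eq in cong₂ _,_ eq₁ eq₂)
      (λ z → mk⇔ (λ r → let (x , y , px , qy , eq) = to (R⇔ z) r in (x , y) , (px , qy) , eq)
                 (λ ((x , y) , (px , qy) , eq) → from (R⇔ z) (x , y , px , qy , eq)))

HasSize-Fin : ∀ n → HasSize (λ (i : Fin n) → ⊤) n
HasSize-Fin n = allFin n , Unique.allFin⁺ n , (λ i → mk⇔ (λ _ → tt) (λ _ → ∈-allFin i)) , length-tabulate (λ i → i)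

HasSize-≥ : ∀ c n → HasSize (λ (x : Fin (c + n)) → c ≤ toℕ x) n
HasSize-≥ zero    n = HasSize-⇔ (HasSize-Fin n) (λ _ → mk⇔ (λ _ → z≤n) (λ _ → tt))
HasSize-≥ (suc c) n = HasSize-map suc (HasSize-≥ c n) (λ _ _ → sucᶠ-injective) preimage
  where
    preimage : ∀ x → suc c ≤ toℕ x ⇔ (∃ λ y → c ≤ toℕ y × suc y ≡ x)
    preimage zero    = mk⇔ (λ ()) (λ { (_ , _ , ()) })
    preimage (suc x) = mk⇔ (λ { (s≤s le) → x , le , refl }) (λ { (_ , le , refl) → s≤s le })

HasSize-∉ : ∀ {n} (xs : List (Fin n)) → Unique xs → HasSize (_∉ xs) (n ∸ length xs)
HasSize-∉ {n} []       u = HasSize-⇔ (HasSize-Fin n) (λ _ → mk⇔ (λ _ ()) (λ _ → tt))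
HasSize-∉ {n} (x ∷ xs) u@(_ ∷ uxs) =
  subst (HasSize _) (trans (∸-+-assoc n (length xs) 1) (cong (n ∸_) (+-comm (length xs) 1)))
    (HasSize-⇔ (HasSize-remove x (HasSize-∉ xs uxs) (Unique.Unique[x∷xs]⇒x∉xs u))
      (λ _ → mk⇔ (λ { (y∉xs , y≢x) (here eq) → y≢x eq ; (y∉xs , _) (there p) → y∉xs p })
                 (λ y∉ → y∉ ∘ there , y∉ ∘ here)))

HasSize-∁ : ∀ {n} {P : Fin n → Set} {c} → HasSize P c → HasSize (¬_ ∘ P) (n ∸ c)
HasSize-∁ (xs , u , iff , refl) =
  HasSize-⇔ (HasSize-∉ xs u) (λ y → mk⇔ (λ y∉ py → y∉ (from (iff y) py)) (λ ¬py y∈ → ¬py (to (iff y) y∈)))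

module _ {A : Set} where

  permutations-count : ∀ (xs : List A) → Unique xs → HasSize (Enumeration (_∈ xs)) (length xs !)
  permutations-count []       _ =
    [ [] ] , [] ∷ [] ,
    (λ ys → mk⇔ (λ { (here refl) → [] , (λ _ → mk⇔ (λ ()) (λ ())) })
                (λ (_ , iff) → here (empty ys iff))) ,
    refl
    where
      empty : ∀ ys → (∀ y → y ∈ ys ⇔ y ∈ []) → ys ≡ []
      empty []      _   = refl
      empty (y ∷ _) iff with to (iff y) (here refl)
      ... | ()
  permutations-count (x ∷ xs) ux@(_ ∷ uxs) =
    HasSize-map₂ (λ (i : Fin (suc (length xs))) zs → insertAt (toℕ i) x zs)
      (HasSize-Fin (suc (length xs))) (permutations-count xs uxs) injective surjective
    where
      x∉xs : x ∉ xs
      x∉xs = Unique.Unique[x∷xs]⇒x∉xs ux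
      prefix-length : ∀ (i : Fin (suc (length xs))) {zs} → Enumeration (_∈ xs) zs → length (take (toℕ i) zs) ≡ toℕ i
      prefix-length i {zs} e = trans (length-take (toℕ i) zs)
        (m≤n⇒m⊓n≡m (subst (toℕ i ≤_) (sym (enumeration-length uxs e)) (≤-pred (toℕ<n i))))
      injective : ∀ {i zs i′ zs′} → ⊤ → Enumeration (_∈ xs) zs → ⊤ → Enumeration (_∈ xs) zs′ →
                  insertAt (toℕ i) x zs ≡ insertAt (toℕ i′) x zs′ → i ≡ i′ × zs ≡ zs′
      injective {i} {zs} {i′} {zs′} _ e _ e′ eq
        with Unique-split-unique (take (toℕ i) zs) (drop (toℕ i) zs) (take (toℕ i′) zs′) (drop (toℕ i′) zs′)
               (proj₁ (enumeration-insert (toℕ i) x∉xs e)) eq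
      ... | eq₁ , eq₂ =
        toℕ-injective (trans (sym (prefix-length i e)) (trans (cong length eq₁) (prefix-length i′ e′))) ,
        trans (sym (take++drop≡id (toℕ i) zs)) (trans (cong₂ _++_ eq₁ eq₂) (take++drop≡id (toℕ i′) zs′))
      surjective : ∀ ys → Enumeration (_∈ x ∷ xs) ys ⇔
                   (∃₂ λ i zs → ⊤ × Enumeration (_∈ xs) zs × insertAt (toℕ i) x zs ≡ ys)
      surjective ys = mk⇔ to′ (λ { (i , zs , _ , e , refl) → enumeration-insert (toℕ i) x∉xs e })
        where
          to′ : Enumeration (_∈ x ∷ xs) ys → ∃₂ λ i zs → ⊤ × Enumeration (_∈ xs) zs × insertAt (toℕ i) x zs ≡ ys
          to′ e with enumeration-split ux e
          ... | zs , ws , refl , e′ =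
            fromℕ< zs< , zs ++ ws , tt , e′ ,
            trans (cong (λ i → insertAt i x (zs ++ ws)) (toℕ-fromℕ< zs<))
                  (cong₂ (λ as bs → as ++ x ∷ bs) (take-length zs ws) (drop-length zs ws))
            where
              zs< : length zs < suc (length xs)
              zs< = s≤s (subst (length zs ≤_) (trans (sym (length-++ zs)) (enumeration-length uxs e′))
                                              (m≤m+n (length zs) (length ws)))
              take-length : ∀ (as bs : List A) → take (length as) (as ++ bs) ≡ as
              take-length []       bs = refl
              take-length (a ∷ as) bs = cong (a ∷_) (take-length as bs)
              drop-length : ∀ (as bs : List A) → drop (length as) (as ++ bs) ≡ bs
              drop-length []       bs = refl
              drop-length (a ∷ as) bs = drop-length as bs

  enumerations-count : ∀ {P : A → Set} {c} → HasSize P c → HasSize (Enumeration P) (c !)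
  enumerations-count (xs , u , iff , refl) =
    HasSize-⇔ (permutations-count xs u) (λ ys → mk⇔ (Enumeration-⇔ iff) (Enumeration-⇔ (⇔.sym ∘ iff)))

  Enumeration-length : ∀ {P : A → Set} {c xs} → HasSize P c → Enumeration P xs → length xs ≡ c
  Enumeration-length (ys , u , iff , refl) e =
    enumeration-length u (Enumeration-⇔ (⇔.sym ∘ iff) e)

module _ {A : Set} where

  tabulate-consecutive⁺ : ∀ {N} (f : Fin N → A) t s → toℕ s ≡ suc (toℕ t) → Consecutive (tabulate f) (f t) (f s)
  tabulate-consecutive⁺ f zero    (suc zero) refl = [] , tabulate (λ i → f (suc (suc i))) , refl
  tabulate-consecutive⁺ f (suc t) (suc s)    eq with tabulate-consecutive⁺ (f ∘ suc) t s (suc-injective eq)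
  ... | xs , ys , eq′ = f zero ∷ xs , ys , cong (f zero ∷_) eq′

  tabulate-consecutive⁻ : ∀ {N} (f : Fin N → A) {u w} → Consecutive (tabulate f) u w →
                          ∃₂ λ t s → toℕ s ≡ suc (toℕ t) × f t ≡ u × f s ≡ w
  tabulate-consecutive⁻ {zero}          f ([] , _ , ())
  tabulate-consecutive⁻ {zero}          f (_ ∷ _ , _ , ())
  tabulate-consecutive⁻ {suc zero}      f ([] , _ , eq) with ∷-injectiveʳ eq
  ... | ()
  tabulate-consecutive⁻ {suc (suc N)} f ([] , _ , eq) with ∷-injective eq
  ... | eq₁ , eq₂ = zero , suc zero , refl , eq₁ , ∷-injectiveˡ eq₂
  tabulate-consecutive⁻ {suc N} f (_ ∷ xs , ys , eq) with tabulate-consecutive⁻ (f ∘ suc) (xs , ys , ∷-injectiveʳ eq)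
  ... | t , s , eq′ , eq₁ , eq₂ = suc t , suc s , cong suc eq′ , eq₁ , eq₂

  private
    tabulate-∷ʳ : ∀ N (f : Fin (suc N) → A) → tabulate f ≡ tabulate (f ∘ inject₁) ++ [ f (fromℕ N) ]
    tabulate-∷ʳ zero    f = refl
    tabulate-∷ʳ (suc N) f = cong (f zero ∷_) (tabulate-∷ʳ N (f ∘ suc))

  tabulate-wrapsAround⁺ : ∀ N (f : Fin (suc (suc N)) → A) → WrapsAround (tabulate f) (f (fromℕ (suc N))) (f zero)
  tabulate-wrapsAround⁺ N f = tabulate (λ i → f (suc (inject₁ i))) , cong (f zero ∷_) (tabulate-∷ʳ N (f ∘ suc))

  tabulate-wrapsAround⁻ : ∀ N (f : Fin (suc (suc N)) → A) {u w} → WrapsAround (tabulate f) u w →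
                          f (fromℕ (suc N)) ≡ u × f zero ≡ w
  tabulate-wrapsAround⁻ N f (xs , eq) =
    ∷ʳ-injectiveʳ (f zero ∷ tabulate (λ i → f (suc (inject₁ i)))) (_ ∷ xs)
      (trans (sym (cong (f zero ∷_) (tabulate-∷ʳ N (f ∘ suc)))) eq) ,
    ∷-injectiveˡ eq

  Unique-tabulate⁻ : ∀ {N} (f : Fin N → A) → Unique (tabulate f) → ∀ {i j} → f i ≡ f j → i ≡ j
  Unique-tabulate⁻ f u       {zero}  {zero}  eq = refl
  Unique-tabulate⁻ f (h ∷ u) {zero}  {suc j} eq = ⊥-elim (All.lookup h (∈-tabulate⁺ j) eq)
  Unique-tabulate⁻ f (h ∷ u) {suc i} {zero}  eq = ⊥-elim (All.lookup h (∈-tabulate⁺ i) (sym eq))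
  Unique-tabulate⁻ f (h ∷ u) {suc i} {suc j} eq = cong suc (Unique-tabulate⁻ (f ∘ suc) u eq)

  nth : List A → ℕ → A → A
  nth []       _       d = d
  nth (x ∷ xs) zero    d = x
  nth (x ∷ xs) (suc i) d = nth xs i d

  tabulate-nth : ∀ {N} (xs : List A) (d : Fin N → A) → length xs ≡ N → tabulate (λ t → nth xs (toℕ t) (d t)) ≡ xs
  tabulate-nth []       d refl = refl
  tabulate-nth (x ∷ xs) d refl = cong (x ∷_) (tabulate-nth xs (d ∘ suc) refl)

  CyclicNext : ∀ N → Fin N → Fin N → Set
  CyclicNext N t s = toℕ s ≡ suc (toℕ t) ⊎ (suc (toℕ t) ≡ N × toℕ s ≡ 0)

  SequenceEdge : ∀ {N} → (Fin N → A) → A → A → Set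
  SequenceEdge {N} σ u w = ∃ λ t → ∃ λ s → CyclicNext N t s × ((σ t ≡ u × σ s ≡ w) ⊎ (σ t ≡ w × σ s ≡ u))

  sequenceEdge⇔cyclicEdge : ∀ N (σ : Fin (suc (suc N)) → A) u w → SequenceEdge σ u w ⇔ CyclicEdge (tabulate σ) u w
  sequenceEdge⇔cyclicEdge N σ u w = mk⇔ to′ from′
    where
      wrap : ∀ t s → suc (toℕ t) ≡ suc (suc N) → toℕ s ≡ 0 → WrapsAround (tabulate σ) (σ t) (σ s)
      wrap t s eqt eqs
        with toℕ-injective {i = t} {j = fromℕ (suc N)} (trans (suc-injective eqt) (sym (toℕ-fromℕ (suc N))))
           | toℕ-injective {i = s} {j = zero} eqs
      ... | refl | refl = tabulate-wrapsAround⁺ N σ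
      to′ : SequenceEdge σ u w → CyclicEdge (tabulate σ) u w
      to′ (t , s , inj₁ eq , inj₁ (refl , refl))         = inj₁ (inj₁ (tabulate-consecutive⁺ σ t s eq))
      to′ (t , s , inj₁ eq , inj₂ (refl , refl))         = inj₂ (inj₁ (tabulate-consecutive⁺ σ t s eq))
      to′ (t , s , inj₂ (eqt , eqs) , inj₁ (refl , refl)) = inj₁ (inj₂ (wrap t s eqt eqs))
      to′ (t , s , inj₂ (eqt , eqs) , inj₂ (refl , refl)) = inj₂ (inj₂ (wrap t s eqt eqs))
      last→first : CyclicNext (suc (suc N)) (fromℕ (suc N)) zero
      last→first = inj₂ (cong suc (toℕ-fromℕ (suc N)) , refl)
      from′ : CyclicEdge (tabulate σ) u w → SequenceEdge σ u w
      from′ (inj₁ (inj₁ c)) = let (t , s , eq , eq₁ , eq₂) = tabulate-consecutive⁻ σ c in t , s , inj₁ eq , inj₁ (eq₁ , eq₂)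
      from′ (inj₂ (inj₁ c)) = let (t , s , eq , eq₁ , eq₂) = tabulate-consecutive⁻ σ c in t , s , inj₁ eq , inj₂ (eq₁ , eq₂)
      from′ (inj₁ (inj₂ c)) = let (eq₁ , eq₂) = tabulate-wrapsAround⁻ N σ c in _ , _ , last→first , inj₁ (eq₁ , eq₂)
      from′ (inj₂ (inj₂ c)) = let (eq₁ , eq₂) = tabulate-wrapsAround⁻ N σ c in _ , _ , last→first , inj₂ (eq₁ , eq₂)

injective⇒surjective : ∀ {N} (f : Fin (suc N) → Fin (suc N)) → (∀ {i j} → f i ≡ f j → i ≡ j) →
                       ∀ z → ∃ λ t → f t ≡ z
injective⇒surjective {N} f inj z with any? (λ t → f t ≟ᶠ z)
... | yes p  = p
... | no ¬p = ⊥-elim (<-irrefl refl (injective⇒≤ {f = g} g-injective))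
  where
    g : Fin (suc N) → Fin N
    g t = punchOut {i = z} {j = f t} (λ eq → ¬p (t , sym eq))
    g-injective : ∀ {i j} → g i ≡ g j → i ≡ j
    g-injective {i} {j} eq = inj (punchOut-injective (λ eq → ¬p (i , sym eq)) (λ eq → ¬p (j , sym eq)) eq)

sequenceEdge? : ∀ {N} (σ : Fin N → Fin N) u w → Dec (SequenceEdge σ u w)
sequenceEdge? {N} σ u w = any? λ t → any? λ s →
  ((toℕ s ≟ suc (toℕ t)) ⊎-dec ((suc (toℕ t) ≟ N) ×-dec (toℕ s ≟ 0))) ×-dec
  ((σ t ≟ᶠ u ×-dec σ s ≟ᶠ w) ⊎-dec (σ t ≟ᶠ w ×-dec σ s ≟ᶠ u))

module _ {N : ℕ} where

  Matrix : Set
  Matrix = Vec (Vec Bool N) N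

  entry : Matrix → Fin N → Fin N → Bool
  entry H u w = Vec.lookup (Vec.lookup H u) w

  -- Abstract, so that entries of a matrix are never computed by deciding R.
  abstract
    toMatrix : ∀ {R : Fin N → Fin N → Set} → (∀ u w → Dec (R u w)) → Matrix
    toMatrix R? = Vec.tabulate λ u → Vec.tabulate λ w → does (R? u w)

    toMatrix-entry : ∀ {R : Fin N → Fin N → Set} (R? : ∀ u w → Dec (R u w)) u w → entry (toMatrix R?) u w ≡ true ⇔ R u w
    toMatrix-entry R? u w
      rewrite Vec.lookup∘tabulate (λ u → Vec.tabulate λ w → does (R? u w)) u
            | Vec.lookup∘tabulate (λ w → does (R? u w)) w
      with R? u w
    ... | yes r  = mk⇔ (λ _ → r) (λ _ → refl)
    ... | no ¬r = mk⇔ (λ ()) (λ r → ⊥-elim (¬r r))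

  matrix-ext : ∀ {H H′ : Matrix} → (∀ u w → entry H u w ≡ true ⇔ entry H′ u w ≡ true) → H ≡ H′
  matrix-ext {H} {H′} H⇔H′ = begin
    H                                                    ≡⟨ Vec.tabulate∘lookup H ⟨
    Vec.tabulate (Vec.lookup H)                          ≡⟨ Vec.tabulate-cong row ⟩
    Vec.tabulate (Vec.lookup H′)                         ≡⟨ Vec.tabulate∘lookup H′ ⟩
    H′                                                   ∎
    where
      open ≡-Reasoning
      bool-ext : ∀ {a b : Bool} → (a ≡ true ⇔ b ≡ true) → a ≡ b
      bool-ext {true}  {true}  _ = refl
      bool-ext {true}  {false} e = sym (to e refl)
      bool-ext {false} {true}  e = from e refl
      bool-ext {false} {false} _ = refl
      row : ∀ u → Vec.lookup H u ≡ Vec.lookup H′ u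
      row u = trans (sym (Vec.tabulate∘lookup (Vec.lookup H u)))
             (trans (Vec.tabulate-cong (λ w → bool-ext (H⇔H′ u w))) (Vec.tabulate∘lookup (Vec.lookup H′ u)))

module Graph (k′ m′ : ℕ) where

  k m : ℕ
  k = suc (suc (suc k′))
  m = suc (suc m′)

  open G k m public

  -- Adj u w unfolds to InBlock u w ⊎ Cross u w ⊎ Cross w u.
  Cross : V → V → Set
  Cross s t = toℕ (block t) ≡ suc (toℕ (block s))
            × ((toℕ (pos s) ≡ 0 × toℕ (pos t) ≡ 0) ⊎ (toℕ (pos s) ≡ 1 × toℕ (pos t) ≡ 2))

  InBlock : V → V → Set
  InBlock u w = block u ≡ block w × pos u ≢ pos w × ¬ Deleted (block u) (pos u) (pos w)

  vertex : Fin m → Fin (suc k) → V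
  vertex = combine

  vertex-ext : ∀ {u w} → block u ≡ block w → pos u ≡ pos w → u ≡ w
  vertex-ext {u} {w} eq₁ eq₂ = begin
    u                            ≡⟨ combine-remQuot {m} (suc k) u ⟨
    combine (block u) (pos u)    ≡⟨ cong₂ combine eq₁ eq₂ ⟩
    combine (block w) (pos w)    ≡⟨ combine-remQuot {m} (suc k) w ⟩
    w                            ∎
    where open ≡-Reasoning

  block-vertex : ∀ i x → block (vertex i x) ≡ i
  block-vertex i x = cong proj₁ (remQuot-combine {m} {suc k} i x)

  pos-vertex : ∀ i x → pos (vertex i x) ≡ x
  pos-vertex i x = cong proj₂ (remQuot-combine {m} {suc k} i x)

  vertex-unique : ∀ {w i x} → block w ≡ i → pos w ≡ x → w ≡ vertex i x
  vertex-unique {i = i} {x} eq₁ eq₂ =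
    vertex-ext (trans eq₁ (sym (block-vertex i x))) (trans eq₂ (sym (pos-vertex i x)))

  -- A deleted edge and an added edge at u exist together: forward ones iff HasFwd, backward ones iff HasBwd.
  module Neighbours (u : V) where

    private
      i : Fin m
      i = block u
      x : Fin (suc k)
      x = pos u

    FwdDeleted BwdDeleted : Fin (suc k) → Set
    FwdDeleted y = UPair x y 0 1 × suc (toℕ i) < m
    BwdDeleted y = UPair x y 0 2 × 0 < toℕ i

    HasFwd HasBwd : Set
    HasFwd = suc (toℕ i) < m × (toℕ x ≡ 0 ⊎ toℕ x ≡ 1)
    HasBwd = 0 < toℕ i × (toℕ x ≡ 0 ⊎ toℕ x ≡ 2)

    fwd? : Dec HasFwd
    fwd? = suc (toℕ i) <? m ×-dec (toℕ x ≟ 0 ⊎-dec toℕ x ≟ 1)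

    bwd? : Dec HasBwd
    bwd? = 0 <? toℕ i ×-dec (toℕ x ≟ 0 ⊎-dec toℕ x ≟ 2)

    fwdDeleted-size : HasSize FwdDeleted ‖ fwd? ‖
    fwdDeleted-size = HasSize-dec fwd? partner absent
      where
        partner : HasFwd → ∃ λ a → ∀ y → FwdDeleted y ⇔ y ≡ a
        partner (lt , inj₁ x≡0) = suc zero , λ y → mk⇔
          (λ { (inj₁ (_ , y≡1) , _) → toℕ-injective y≡1 ; (inj₂ (x≡1 , _) , _) → ⊥-elim (0≢1+n (trans (sym x≡0) x≡1)) })
          (λ { refl → inj₁ (x≡0 , refl) , lt })
        partner (lt , inj₂ x≡1) = zero , λ y → mk⇔
          (λ { (inj₂ (_ , y≡0) , _) → toℕ-injective y≡0 ; (inj₁ (x≡0 , _) , _) → ⊥-elim (0≢1+n (trans (sym x≡0) x≡1)) })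
          (λ { refl → inj₂ (x≡1 , refl) , lt })
        absent : ¬ HasFwd → ∀ y → ¬ FwdDeleted y
        absent ¬fwd y (inj₁ (x≡0 , _) , lt) = ¬fwd (lt , inj₁ x≡0)
        absent ¬fwd y (inj₂ (x≡1 , _) , lt) = ¬fwd (lt , inj₂ x≡1)

    bwdDeleted-size : HasSize BwdDeleted ‖ bwd? ‖
    bwdDeleted-size = HasSize-dec bwd? partner absent
      where
        partner : HasBwd → ∃ λ a → ∀ y → BwdDeleted y ⇔ y ≡ a
        partner (lt , inj₁ x≡0) = suc (suc zero) , λ y → mk⇔
          (λ { (inj₁ (_ , y≡2) , _) → toℕ-injective y≡2 ; (inj₂ (x≡2 , _) , _) → ⊥-elim (0≢1+n (trans (sym x≡0) x≡2)) })
          (λ { refl → inj₁ (x≡0 , refl) , lt })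
        partner (lt , inj₂ x≡2) = zero , λ y → mk⇔
          (λ { (inj₂ (_ , y≡0) , _) → toℕ-injective y≡0 ; (inj₁ (x≡0 , _) , _) → ⊥-elim (0≢1+n (trans (sym x≡0) x≡2)) })
          (λ { refl → inj₂ (x≡2 , refl) , lt })
        absent : ¬ HasBwd → ∀ y → ¬ BwdDeleted y
        absent ¬bwd y (inj₁ (x≡0 , _) , lt) = ¬bwd (lt , inj₁ x≡0)
        absent ¬bwd y (inj₂ (x≡2 , _) , lt) = ¬bwd (lt , inj₂ x≡2)

    fwdCross-size : HasSize (Cross u) ‖ fwd? ‖
    fwdCross-size = HasSize-dec fwd? partner absent
      where
        next-block : ∀ {w} (lt : suc (toℕ i) < m) → toℕ (block w) ≡ suc (toℕ i) → block w ≡ fromℕ< lt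
        next-block lt eq = toℕ-injective (trans eq (sym (toℕ-fromℕ< lt)))
        at-next-block : ∀ (lt : suc (toℕ i) < m) y → toℕ (block (vertex (fromℕ< lt) y)) ≡ suc (toℕ i)
        at-next-block lt y = trans (cong toℕ (block-vertex (fromℕ< lt) y)) (toℕ-fromℕ< lt)
        partner : HasFwd → ∃ λ w → ∀ w′ → Cross u w′ ⇔ w′ ≡ w
        partner (lt , inj₁ x≡0) = vertex (fromℕ< lt) zero , λ w → mk⇔
          (λ { (eq , inj₁ (_ , w≡0)) → vertex-unique {w} (next-block {w} lt eq) (toℕ-injective w≡0)
             ; (_ , inj₂ (x≡1 , _)) → ⊥-elim (0≢1+n (trans (sym x≡0) x≡1)) })
          (λ { refl → at-next-block lt zero , inj₁ (x≡0 , cong toℕ (pos-vertex (fromℕ< lt) zero)) })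
        partner (lt , inj₂ x≡1) = vertex (fromℕ< lt) (suc (suc zero)) , λ w → mk⇔
          (λ { (eq , inj₂ (_ , w≡2)) → vertex-unique {w} (next-block {w} lt eq) (toℕ-injective w≡2)
             ; (_ , inj₁ (x≡0 , _)) → ⊥-elim (0≢1+n (trans (sym x≡0) x≡1)) })
          (λ { refl → at-next-block lt _ , inj₂ (x≡1 , cong toℕ (pos-vertex (fromℕ< lt) (suc (suc zero)))) })
        absent : ¬ HasFwd → ∀ w → ¬ Cross u w
        absent ¬fwd w (eq , xw) =
          ¬fwd (subst (_< m) eq (toℕ<n (block w)) , Sum.map proj₁ proj₁ xw)

    bwdCross-size : HasSize (λ w → Cross w u) ‖ bwd? ‖
    bwdCross-size = HasSize-dec bwd? partner absent
      where
        prev-lt : 0 < toℕ i → pred (toℕ i) < m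
        prev-lt _ = ≤-<-trans pred[n]≤n (toℕ<n i)
        prev-block : ∀ {w} (gt : 0 < toℕ i) → toℕ i ≡ suc (toℕ (block w)) → block w ≡ fromℕ< (prev-lt gt)
        prev-block gt eq = toℕ-injective (trans (cong pred (sym eq)) (sym (toℕ-fromℕ< (prev-lt gt))))
        at-prev-block : ∀ (gt : 0 < toℕ i) y → toℕ i ≡ suc (toℕ (block (vertex (fromℕ< (prev-lt gt)) y)))
        at-prev-block gt y =
          trans (sym (suc-pred (toℕ i) {{>-nonZero gt}}))
                (cong suc (sym (trans (cong toℕ (block-vertex _ y)) (toℕ-fromℕ< (prev-lt gt)))))
        partner : HasBwd → ∃ λ w → ∀ w′ → Cross w′ u ⇔ w′ ≡ w
        partner (gt , inj₁ x≡0) = vertex (fromℕ< (prev-lt gt)) zero , λ w → mk⇔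
          (λ { (eq , inj₁ (w≡0 , _)) → vertex-unique {w} (prev-block {w} gt eq) (toℕ-injective w≡0)
             ; (_ , inj₂ (_ , x≡2)) → ⊥-elim (0≢1+n (trans (sym x≡0) x≡2)) })
          (λ { refl → at-prev-block gt zero , inj₁ (cong toℕ (pos-vertex (fromℕ< (prev-lt gt)) zero) , x≡0) })
        partner (gt , inj₂ x≡2) = vertex (fromℕ< (prev-lt gt)) (suc zero) , λ w → mk⇔
          (λ { (eq , inj₂ (w≡1 , _)) → vertex-unique {w} (prev-block {w} gt eq) (toℕ-injective w≡1)
             ; (_ , inj₁ (_ , x≡0)) → ⊥-elim (0≢1+n (trans (sym x≡0) x≡2)) })
          (λ { refl → at-prev-block gt _ , inj₂ (cong toℕ (pos-vertex (fromℕ< (prev-lt gt)) (suc zero)) , x≡2) })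
        absent : ¬ HasBwd → ∀ w → ¬ Cross w u
        absent ¬bwd w (eq , xw) = ¬bwd (subst (0 <_) (sym eq) (s≤s z≤n) , Sum.map proj₂ proj₂ xw)

    private
      Δ : ℕ
      Δ = ‖ fwd? ‖ + ‖ bwd? ‖

    Excluded : Fin (suc k) → Set
    Excluded y = y ≡ x ⊎ Deleted i x y

    excluded-size : HasSize Excluded (1 + Δ)
    excluded-size =
      HasSize-⊎ (HasSize-singleton x) (HasSize-⊎ fwdDeleted-size bwdDeleted-size fwd-bwd-disjoint) self-not-deleted
      where
        self-not-deleted : ∀ y → y ≡ x → ¬ Deleted i x y
        self-not-deleted y refl (inj₁ (inj₁ (x≡0 , x≡1) , _)) = 0≢1+n (trans (sym x≡0) x≡1)
        self-not-deleted y refl (inj₁ (inj₂ (x≡1 , x≡0) , _)) = 0≢1+n (trans (sym x≡0) x≡1)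
        self-not-deleted y refl (inj₂ (inj₁ (x≡0 , x≡2) , _)) = 0≢1+n (trans (sym x≡0) x≡2)
        self-not-deleted y refl (inj₂ (inj₂ (x≡2 , x≡0) , _)) = 0≢1+n (trans (sym x≡0) x≡2)
        fwd-bwd-disjoint : ∀ y → FwdDeleted y → ¬ BwdDeleted y
        fwd-bwd-disjoint y (inj₁ (_ , y≡1) , _) (inj₁ (_ , y≡2) , _) = 0≢1+n (suc-injective (trans (sym y≡1) y≡2))
        fwd-bwd-disjoint y (inj₁ (x≡0 , _) , _) (inj₂ (x≡2 , _) , _) = 0≢1+n (trans (sym x≡0) x≡2)
        fwd-bwd-disjoint y (inj₂ (x≡1 , _) , _) (inj₁ (x≡0 , _) , _) = 0≢1+n (trans (sym x≡0) x≡1)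
        fwd-bwd-disjoint y (inj₂ (x≡1 , _) , _) (inj₂ (x≡2 , _) , _) = 0≢1+n (suc-injective (trans (sym x≡1) x≡2))

    inBlock-size : HasSize (InBlock u) (k ∸ Δ)
    inBlock-size = HasSize-map (vertex i) (HasSize-∁ excluded-size)
      (λ _ _ eq → proj₂ (combine-injective i _ i _ eq))
      (λ w → mk⇔ (to′ w) from′)
      where
        to′ : ∀ w → InBlock u w → ∃ λ y → ¬ Excluded y × vertex i y ≡ w
        to′ w (i≡bw , x≢pw , ¬del) =
          pos w , Sum.[ x≢pw ∘ sym , ¬del ] , sym (vertex-unique {w} (sym i≡bw) refl)
        from′ : ∀ {w} → (∃ λ y → ¬ Excluded y × vertex i y ≡ w) → InBlock u w
        from′ (y , ¬ex , refl) rewrite block-vertex i y | pos-vertex i y =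
          refl , ¬ex ∘ inj₁ ∘ sym , ¬ex ∘ inj₂

    degree : HasSize (Adj u) k
    degree = subst (HasSize (Adj u)) (m∸n+n≡m Δ≤k)
      (HasSize-⇔ (HasSize-⊎ inBlock-size (HasSize-⊎ fwdCross-size bwdCross-size cross-disjoint) inBlock-disjoint)
                 (λ _ → ⇔.refl))
      where
        Δ≤k : Δ ≤ k
        Δ≤k = ≤-trans (+-mono-≤ (‖‖≤1 fwd?) (‖‖≤1 bwd?)) (s≤s (s≤s z≤n))
        cross-disjoint : ∀ w → Cross u w → ¬ Cross w u
        cross-disjoint w (eq , _) (eq′ , _) = <⇒≢ (m<n⇒m<1+n (n<1+n _)) (trans eq′ (cong suc eq))
        inBlock-disjoint : ∀ w → InBlock u w → ¬ (Cross u w ⊎ Cross w u)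
        inBlock-disjoint w (i≡bw , _) (inj₁ (eq , _)) = 1+n≢n (trans (sym eq) (cong toℕ (sym i≡bw)))
        inBlock-disjoint w (i≡bw , _) (inj₂ (eq , _)) = 1+n≢n (trans (sym eq) (cong toℕ i≡bw))

  regular : Regular k
  regular u = Neighbours.degree u

  -- Abstract, so that unification never unfolds remQuot.
  abstract
    blockNo posNo : V → ℕ
    blockNo u = toℕ (block u)
    posNo u = toℕ (pos u)

    blockNo<m : ∀ u → blockNo u < m
    blockNo<m u = toℕ<n (block u)

    coordinates-injective : ∀ {u w} → blockNo u ≡ blockNo w → posNo u ≡ posNo w → u ≡ w
    coordinates-injective eq₁ eq₂ = vertex-ext (toℕ-injective eq₁) (toℕ-injective eq₂)

    blockNo-vertex : ∀ i x → blockNo (vertex i x) ≡ toℕ i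
    blockNo-vertex i x = cong toℕ (block-vertex i x)

    posNo-vertex : ∀ i x → posNo (vertex i x) ≡ toℕ x
    posNo-vertex i x = cong toℕ (pos-vertex i x)

    blockNo≡toℕ⇒vertex : ∀ {z} j → blockNo z ≡ toℕ j → z ≡ vertex j (pos z) × posNo z ≡ toℕ (pos z)
    blockNo≡toℕ⇒vertex j eq = vertex-unique (toℕ-injective eq) refl , refl

  At : ℕ → ℕ → V → Set
  At j x z = blockNo z ≡ j × posNo z ≡ x

  At-unique : ∀ {j x u w} → At j x u → At j x w → u ≡ w
  At-unique (eq₁ , eq₂) (eq₁′ , eq₂′) = coordinates-injective (trans eq₁ (sym eq₁′)) (trans eq₂ (sym eq₂′))

  posNo-cases : ∀ z → posNo z ≡ 0 ⊎ posNo z ≡ 1 ⊎ posNo z ≡ 2 ⊎ 3 ≤ posNo z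
  posNo-cases z with posNo z
  ... | 0 = inj₁ refl
  ... | 1 = inj₂ (inj₁ refl)
  ... | 2 = inj₂ (inj₂ (inj₁ refl))
  ... | suc (suc (suc _)) = inj₂ (inj₂ (inj₂ (s≤s (s≤s (s≤s z≤n)))))

  At⇒¬3≤posNo : ∀ {j x z} → x < 3 → At j x z → ¬ (3 ≤ posNo z)
  At⇒¬3≤posNo x<3 (_ , refl) 3≤x = <⇒≱ x<3 3≤x

  v[_] a[_] b[_] : Fin m → V
  v[ j ] = vertex j zero
  a[ j ] = vertex j (suc zero)
  b[ j ] = vertex j (suc (suc zero))

  At-v : ∀ j → At (toℕ j) 0 v[ j ]
  At-v j = blockNo-vertex j _ , posNo-vertex j _

  At-a : ∀ j → At (toℕ j) 1 a[ j ]
  At-a j = blockNo-vertex j _ , posNo-vertex j _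

  At-b : ∀ j → At (toℕ j) 2 b[ j ]
  At-b j = blockNo-vertex j _ , posNo-vertex j _

  v₀ v₁ a₀ : V
  v₀ = v[ zero ]
  v₁ = v[ suc zero ]
  a₀ = a[ zero ]

  last : Fin m
  last = fromℕ (suc m′)

  At-last : ∀ {x z} → At (toℕ last) x z → At (suc m′) x z
  At-last (z-last , zx) = trans z-last (toℕ-fromℕ (suc m′)) , zx

  UPairℕ : ℕ → ℕ → ℕ → ℕ → Set
  UPairℕ x y a b = (x ≡ a × y ≡ b) ⊎ (x ≡ b × y ≡ a)

  Deletedℕ : ℕ → ℕ → ℕ → Set
  Deletedℕ i x y = (UPairℕ x y 0 1 × suc i < m) ⊎ (UPairℕ x y 0 2 × 0 < i)

  Crossℕ : V → V → Set
  Crossℕ s t = blockNo t ≡ suc (blockNo s) × ((posNo s ≡ 0 × posNo t ≡ 0) ⊎ (posNo s ≡ 1 × posNo t ≡ 2))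

  InBlockℕ : V → V → Set
  InBlockℕ u w = blockNo u ≡ blockNo w × posNo u ≢ posNo w × ¬ Deletedℕ (blockNo u) (posNo u) (posNo w)

  abstract
    Adj⇔ℕ : ∀ u w → Adj u w ⇔ (InBlockℕ u w ⊎ Crossℕ u w ⊎ Crossℕ w u)
    Adj⇔ℕ u w = mk⇔
      (λ { (inj₁ (eq , ≢ , ¬del)) → inj₁ (cong toℕ eq , ≢ ∘ toℕ-injective , ¬del) ; (inj₂ c) → inj₂ c })
      (λ { (inj₁ (eq , ≢ , ¬del)) → inj₁ (toℕ-injective eq , ≢ ∘ cong toℕ , ¬del) ; (inj₂ c) → inj₂ c })

  adj-sym : ∀ {u w} → Adj u w → Adj w u
  adj-sym {u} {w} a with to (Adj⇔ℕ u w) a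
  ... | inj₁ (eq , ≢ , ¬del) = from (Adj⇔ℕ w u) (inj₁ (sym eq , ≢ ∘ sym , ¬del ∘ flip))
    where
      flip-pair : ∀ {x y a b} → UPairℕ y x a b → UPairℕ x y a b
      flip-pair (inj₁ (p , q)) = inj₂ (q , p)
      flip-pair (inj₂ (p , q)) = inj₁ (q , p)
      flip : Deletedℕ (blockNo w) (posNo w) (posNo u) → Deletedℕ (blockNo u) (posNo u) (posNo w)
      flip (inj₁ (p , lt)) = inj₁ (flip-pair p , subst (λ i → suc i < m) (sym eq) lt)
      flip (inj₂ (p , lt)) = inj₂ (flip-pair p , subst (0 <_) (sym eq) lt)
  ... | inj₂ (inj₁ c) = from (Adj⇔ℕ w u) (inj₂ (inj₂ c))
  ... | inj₂ (inj₂ c) = from (Adj⇔ℕ w u) (inj₂ (inj₁ c))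

  positions≢0⇒¬deleted : ∀ {i x y} → x ≢ 0 → y ≢ 0 → ¬ Deletedℕ i x y
  positions≢0⇒¬deleted x≢0 y≢0 (inj₁ (inj₁ (x0 , _) , _)) = x≢0 x0
  positions≢0⇒¬deleted x≢0 y≢0 (inj₁ (inj₂ (_ , y0) , _)) = y≢0 y0
  positions≢0⇒¬deleted x≢0 y≢0 (inj₂ (inj₁ (x0 , _) , _)) = x≢0 x0
  positions≢0⇒¬deleted x≢0 y≢0 (inj₂ (inj₂ (_ , y0) , _)) = y≢0 y0

  CutEdge : ℕ → V → V → Set
  CutEdge j u w = (At j 0 u × At (suc j) 0 w) ⊎ (At j 1 u × At (suc j) 2 w)

  cut-edge : ∀ {j u w} → Adj u w → blockNo u ≤ j → j < blockNo w → CutEdge j u w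
  cut-edge {j} {u} {w} a u≤j j<w with to (Adj⇔ℕ u w) a
  ... | inj₁ (eq , _) = ⊥-elim (<⇒≱ j<w (subst (_≤ j) eq u≤j))
  ... | inj₂ (inj₂ (eq , _)) = ⊥-elim (<⇒≱ (<-trans j<w (subst (blockNo w <_) (sym eq) (n<1+n _))) u≤j)
  ... | inj₂ (inj₁ (eq , ends)) with ≤-antisym u≤j (≤-pred (subst (j <_) eq j<w))
  ...   | u≡j with ends
  ...     | inj₁ (u0 , w0) = inj₁ ((u≡j , u0) , (trans eq (cong suc u≡j) , w0))
  ...     | inj₂ (u1 , w2) = inj₂ ((u≡j , u1) , (trans eq (cong suc u≡j) , w2))

  cutEdge⇒adj : ∀ {j u w} → CutEdge j u w → Adj u w
  cutEdge⇒adj {j} {u} {w} (inj₁ ((u-j , u0) , (w-j , w0))) =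
    from (Adj⇔ℕ u w) (inj₂ (inj₁ (trans w-j (cong suc (sym u-j)) , inj₁ (u0 , w0))))
  cutEdge⇒adj {j} {u} {w} (inj₂ ((u-j , u1) , (w-j , w2))) =
    from (Adj⇔ℕ u w) (inj₂ (inj₁ (trans w-j (cong suc (sym u-j)) , inj₂ (u1 , w2))))

  IsWalk : List V → Set
  IsWalk L = ∀ {u w} → Consecutive L u w → Adj u w

  walk-++⁻ˡ : ∀ xs {ys} → IsWalk (xs ++ ys) → IsWalk xs
  walk-++⁻ˡ xs {ys} walk c = walk (consecutive-++⁺ˡ ys c)

  walk-++⁻ʳ : ∀ xs {ys} → IsWalk (xs ++ ys) → IsWalk ys
  walk-++⁻ʳ xs walk c = walk (consecutive-++⁺ʳ xs c)

  walk-++⁺ : ∀ {xs ys} → IsWalk xs → IsWalk ys → (∀ {u w} → Junction xs ys u w → Adj u w) → IsWalk (xs ++ ys)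
  walk-++⁺ {xs} {ys} wxs wys junction (zs , ws , eq) with consecutive-++⁻ xs ys zs ws eq
  ... | inj₁ c        = wxs c
  ... | inj₂ (inj₁ c) = wys c
  ... | inj₂ (inj₂ j) = junction j

  walk-[_] : ∀ x → IsWalk [ x ]
  walk-[ x ] ([] , _ , ())
  walk-[ x ] (_ ∷ [] , _ , ())
  walk-[ x ] (_ ∷ _ ∷ _ , _ , ())

  walk-inBlock : ∀ {i xs} → Unique xs → All (λ z → blockNo z ≡ i) xs →
                 (∀ {u w} → Consecutive xs u w → ¬ Deletedℕ i (posNo u) (posNo w)) → IsWalk xs
  walk-inBlock {i} {xs} uxs in-i ¬del {u} {w} c =
    from (Adj⇔ℕ u w) (inj₁ (trans u∈i (sym w∈i) , u≢w , subst (λ j → ¬ Deletedℕ j _ _) (sym u∈i) (¬del c)))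
    where
      u∈i : blockNo u ≡ i
      u∈i = All.lookup in-i (proj₁ (consecutive-∈ c))
      w∈i : blockNo w ≡ i
      w∈i = All.lookup in-i (proj₂ (consecutive-∈ c))
      u≢w : posNo u ≢ posNo w
      u≢w eq = Unique⇒consecutive-≢ uxs c (coordinates-injective (trans u∈i (sym w∈i)) eq)

  walk-inBlock-ends : ∀ {i x y M} → Unique (x ∷ M ++ [ y ]) → M ≢ [] → All (λ z → blockNo z ≡ i) (x ∷ M ++ [ y ]) →
    (∀ {u w} → u ∈ x ∷ M ++ [ y ] → w ∈ x ∷ M ++ [ y ] → Deletedℕ i (posNo u) (posNo w) →
       (u ≡ x × w ≡ y) ⊎ (u ≡ y × w ≡ x)) →
    IsWalk (x ∷ M ++ [ y ])
  walk-inBlock-ends uS M≢[] in-i ends =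
    walk-inBlock uS in-i λ c del →
      Unique⇒ends-¬consecutive uS M≢[] c (ends (proj₁ (consecutive-∈ c)) (proj₂ (consecutive-∈ c)) del)

  first-exit : ∀ j {h R} → IsWalk (h ∷ R) → blockNo h ≤ j → ¬ All (λ z → blockNo z ≤ j) (h ∷ R) →
               ∃₂ λ X p → ∃₂ λ y Y → h ∷ R ≡ X ++ p ∷ y ∷ Y × All (λ z → blockNo z ≤ j) (X ++ [ p ]) × CutEdge j p y
  first-exit j {h} {R} walk h≤j ¬all with first-failure (λ z → blockNo z ≤? j) h R h≤j ¬all
  ... | X , p , y , Y , eq , all , y≰j =
    X , p , y , Y , eq , all , cut-edge {j} {p} {y} (walk (X , Y , eq)) (All.lookup all (∈-++⁺ʳ X (here refl))) (≰⇒> y≰j)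

  first-entry : ∀ j {h R} → IsWalk (h ∷ R) → j < blockNo h → ¬ All (λ z → j < blockNo z) (h ∷ R) →
                ∃₂ λ X q → ∃₂ λ t T → h ∷ R ≡ X ++ q ∷ t ∷ T × All (λ z → j < blockNo z) (X ++ [ q ]) × CutEdge j t q
  first-entry j {h} {R} walk j<h ¬all with first-failure (λ z → j <? blockNo z) h R j<h ¬all
  ... | X , q , t , T , eq , all , t≯j =
    X , q , t , T , eq , all ,
    cut-edge {j} {t} {q} (adj-sym {q} {t} (walk (X , T , eq))) (≮⇒≥ t≯j) (All.lookup all (∈-++⁺ʳ X (here refl)))

  Interior : ℕ → V → Set
  Interior j z = blockNo z ≡ j × 3 ≤ posNo z

  FirstInterior : V → Set
  FirstInterior z = blockNo z ≡ 0 × 2 ≤ posNo z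

  LastInterior : V → Set
  LastInterior z = blockNo z ≡ suc m′ × (posNo z ≡ 1 ⊎ 3 ≤ posNo z)

  -- The segment b_j ⋯ v_j of the cut cycle.
  Tail : ℕ → List V → Set
  Tail j L = Unique L × IsWalk L × (∀ z → z ∈ L ⇔ j ≤ blockNo z)
           × ∃₂ λ b M → ∃ λ v → L ≡ b ∷ M ++ [ v ] × At j 2 b × At j 0 v

  HamPath : List V → Set
  HamPath L = Unique L × IsWalk L × (∀ z → z ∈ L) × ∃ λ M → L ≡ v₀ ∷ M ++ [ v₁ ]

  hamPath-middle≢[] : ∀ {M} → HamPath (v₀ ∷ M ++ [ v₁ ]) → M ≢ []
  hamPath-middle≢[] (_ , _ , cover , _) refl with cover b[ zero ]
  ... | here eq = 0≢1+n (trans (sym (proj₂ (At-v zero))) (trans (cong posNo (sym eq)) (proj₂ (At-b zero))))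
  ... | there (here eq) = 0≢1+n (trans (sym (proj₂ (At-v (suc zero)))) (trans (cong posNo (sym eq)) (proj₂ (At-b zero))))

  tail-assemble : ∀ {j b p v} X Z → let L = b ∷ X ++ p ∷ Z ++ [ v ] in
    Unique L → IsWalk L → (∀ z → z ∈ L ⇔ j ≤ blockNo z) → At j 2 b → At j 1 p → At j 0 v →
    All (λ z → blockNo z ≤ j) X → All (λ z → j < blockNo z) Z →
    (∃₂ λ y Z₁ → ∃ λ q → Z ≡ y ∷ Z₁ ++ [ q ] × At (suc j) 2 y × At (suc j) 0 q) →
    Enumeration (Interior j) X × Tail (suc j) Z
  tail-assemble {j} {b} {p} {v} X Z uL walk cover b-at p-at v-at X≤j j<Z (y , Z₁ , q , refl , y-at , q-at) =
    (Unique-++⁻ˡ X u₁ , λ z → mk⇔ (X⇒interior z) (interior⇒X z)) ,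
    (Unique-++⁻ˡ Z u₂ , walk-++⁻ˡ Z (walk-++⁻ʳ [ p ] (walk-++⁻ʳ (b ∷ X) walk)) ,
     (λ z → mk⇔ (All.lookup j<Z) (beyond⇒Z z)) , y , Z₁ , q , refl , y-at , q-at)
    where
      u₁ : Unique (X ++ p ∷ Z ++ [ v ])
      u₁ = Unique-++⁻ʳ [ b ] uL
      u₂ : Unique (Z ++ [ v ])
      u₂ = Unique-++⁻ʳ (p ∷ []) (Unique-++⁻ʳ X u₁)
      b∉ : b ∉ X ++ p ∷ Z ++ [ v ]
      b∉ = Unique.Unique[x∷xs]⇒x∉xs uL
      X∉ : ∀ {z} → z ∈ X → z ∉ p ∷ Z ++ [ v ]
      X∉ = Unique-++⇒disjoint X u₁
      in-L : ∀ {z} → j ≤ blockNo z → z ∈ b ∷ X ++ p ∷ Z ++ [ v ]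
      in-L {z} = from (cover z)
      X-block : ∀ {z} → z ∈ X → blockNo z ≡ j
      X-block {z} z∈X = ≤-antisym (All.lookup X≤j z∈X) (to (cover z) (there (∈-++⁺ˡ z∈X)))
      X⇒interior : ∀ z → z ∈ X → Interior j z
      X⇒interior z z∈X with posNo-cases z
      ... | inj₁ z0 = ⊥-elim (X∉ z∈X (subst (_∈ p ∷ Z ++ [ v ]) (sym (At-unique (X-block z∈X , z0) v-at))
                                            (there (∈-++⁺ʳ Z (here refl)))))
      ... | inj₂ (inj₁ z1) = ⊥-elim (X∉ z∈X (here (At-unique (X-block z∈X , z1) p-at)))
      ... | inj₂ (inj₂ (inj₁ z2)) = ⊥-elim (b∉ (subst (_∈ X ++ p ∷ Z ++ [ v ]) (At-unique (X-block z∈X , z2) b-at)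
                                                     (∈-++⁺ˡ z∈X)))
      ... | inj₂ (inj₂ (inj₂ z≥3)) = X-block z∈X , z≥3
      interior⇒X : ∀ z → Interior j z → z ∈ X
      interior⇒X z (z∈j , z≥3) with ∈-five-parts X Z (in-L (≤-reflexive (sym z∈j)))
      ... | inj₁ refl = ⊥-elim (At⇒¬3≤posNo (s≤s (s≤s (s≤s z≤n))) b-at z≥3)
      ... | inj₂ (inj₁ z∈X) = z∈X
      ... | inj₂ (inj₂ (inj₁ refl)) = ⊥-elim (At⇒¬3≤posNo (s≤s (s≤s z≤n)) p-at z≥3)
      ... | inj₂ (inj₂ (inj₂ (inj₁ z∈Z))) = ⊥-elim (<-irrefl (sym z∈j) (All.lookup j<Z z∈Z))
      ... | inj₂ (inj₂ (inj₂ (inj₂ refl))) = ⊥-elim (At⇒¬3≤posNo (s≤s z≤n) v-at z≥3)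
      beyond⇒Z : ∀ z → suc j ≤ blockNo z → z ∈ Z
      beyond⇒Z z j<z with ∈-five-parts X Z (in-L (<⇒≤ j<z))
      ... | inj₁ refl = ⊥-elim (<-irrefl (sym (proj₁ b-at)) j<z)
      ... | inj₂ (inj₁ z∈X) = ⊥-elim (<-irrefl (sym (X-block z∈X)) j<z)
      ... | inj₂ (inj₂ (inj₁ refl)) = ⊥-elim (<-irrefl (sym (proj₁ p-at)) j<z)
      ... | inj₂ (inj₂ (inj₂ (inj₁ z∈Z))) = z∈Z
      ... | inj₂ (inj₂ (inj₂ (inj₂ refl))) = ⊥-elim (<-irrefl (sym (proj₁ v-at)) j<z)

  tail-exit : ∀ {j b M v} → suc j < m → let L = b ∷ M ++ [ v ] in
    Unique L → IsWalk L → (∀ z → z ∈ L ⇔ j ≤ blockNo z) → At j 2 b → At j 0 v →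
    ∃₂ λ X p → ∃₂ λ y Y → M ++ [ v ] ≡ X ++ p ∷ y ∷ Y × All (λ z → blockNo z ≤ j) X × At j 1 p × At (suc j) 2 y
  tail-exit {j} {b} {M} {v} lt uL walk cover b-at v-at =
    case first-exit j walk (≤-reflexive (proj₁ b-at)) leaves of λ where
      (X₀ , p , y , Y , eq , _ , inj₁ (p-at , _)) →
        ⊥-elim (Unique⇒¬consecutive-last {xs = b ∷ M} uL
          (X₀ , Y , subst (λ u → b ∷ M ++ [ v ] ≡ X₀ ++ u ∷ y ∷ Y) (At-unique p-at v-at) eq))
      ([] , p , y , Y , eq , _ , inj₂ (p-at , _)) →
        ⊥-elim (0≢1+n (suc-injective (trans (sym (proj₂ p-at)) (trans (cong posNo (sym (∷-injectiveˡ eq))) (proj₂ b-at)))))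
      (_ ∷ X , p , y , Y , eq , _ ∷ Xp≤j , inj₂ (p-at , y-at)) →
        X , p , y , Y , ∷-injectiveʳ eq , All.++⁻ˡ X Xp≤j , p-at , y-at
    where
      next : V
      next = v[ fromℕ< lt ]
      next-block : blockNo next ≡ suc j
      next-block = trans (proj₁ (At-v (fromℕ< lt))) (toℕ-fromℕ< lt)
      leaves : ¬ All (λ z → blockNo z ≤ j) (b ∷ M ++ [ v ])
      leaves all = 1+n≰n (subst (_≤ j) next-block
        (All.lookup all (from (cover next) (subst (j ≤_) (sym next-block) (n≤1+n j)))))

  tail-return : ∀ {j p v y Y Y₀} → Unique (y ∷ Y) → IsWalk (y ∷ Y) → p ∉ y ∷ Y → y ∷ Y ≡ Y₀ ++ [ v ] →
    At j 1 p → At (suc j) 2 y → At j 0 v →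
    ∃₂ λ Z₁ q → y ∷ Y ≡ (y ∷ Z₁ ++ [ q ]) ++ [ v ] × All (λ z → j < blockNo z) (y ∷ Z₁ ++ [ q ]) × At (suc j) 0 q
  tail-return {j} {p} {v} {y} {Y} {Y₀} uY walk p∉ eqY p-at y-at v-at =
    case first-entry j walk (≤-reflexive (sym (proj₁ y-at))) returns of λ where
      (Z₀ , q , t , T , eq , Zq>j , inj₂ (t-at , _)) →
        ⊥-elim (p∉ (subst (_∈ y ∷ Y) (At-unique t-at p-at) (subst (t ∈_) (sym eq) (∈-++⁺ʳ Z₀ (there (here refl))))))
      (Z₀ , q , t , T , eq , Zq>j , inj₁ (t-at , q-at)) →
        closes Z₀ (subst (λ u → y ∷ Y ≡ Z₀ ++ q ∷ u ∷ T) (At-unique t-at v-at) eq) Zq>j q-at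
    where
      returns : ¬ All (λ z → j < blockNo z) (y ∷ Y)
      returns all = <-irrefl (sym (proj₁ v-at))
        (All.lookup all (subst (v ∈_) (sym eqY) (∈-++⁺ʳ Y₀ (here refl))))
      closes : ∀ Z₀ {q T} → y ∷ Y ≡ Z₀ ++ q ∷ v ∷ T → All (λ z → j < blockNo z) (Z₀ ++ [ q ]) → At (suc j) 0 q →
        ∃₂ λ Z₁ q → y ∷ Y ≡ (y ∷ Z₁ ++ [ q ]) ++ [ v ] × All (λ z → j < blockNo z) (y ∷ Z₁ ++ [ q ]) × At (suc j) 0 q
      closes [] eq _ q-at =
        ⊥-elim (0≢1+n (trans (sym (proj₂ q-at)) (trans (cong posNo (sym (∷-injectiveˡ eq))) (proj₂ y-at))))
      closes (y′ ∷ Z₁) {q} {T} eq Zq>j q-at =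
        Z₁ , q , subst₂ (λ a T → y ∷ Y ≡ (a ∷ Z₁ ++ [ q ]) ++ v ∷ T) (sym y≡y′) T≡[] eq′ ,
        subst (λ a → All (λ z → j < blockNo z) (a ∷ Z₁ ++ [ q ])) (sym y≡y′) Zq>j , q-at
        where
          y≡y′ : y ≡ y′
          y≡y′ = ∷-injectiveˡ eq
          eq′ : y ∷ Y ≡ (y′ ∷ Z₁ ++ [ q ]) ++ v ∷ T
          eq′ = trans eq (sym (++-assoc (y′ ∷ Z₁) [ q ] (v ∷ T)))
          T≡[] : T ≡ []
          T≡[] = proj₂ (Unique-split-unique (y′ ∷ Z₁ ++ [ q ]) T Y₀ [] (subst Unique eq′ uY) (trans (sym eq′) eqY))

  tail-split : ∀ {j L} → suc j < m → Tail j L →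
    ∃₂ λ b X → ∃₂ λ p Z → ∃ λ v → L ≡ b ∷ X ++ p ∷ Z ++ [ v ]
      × At j 2 b × At j 1 p × At j 0 v × Enumeration (Interior j) X × Tail (suc j) Z
  tail-split {j} lt (uL , walk , cover , b , M , v , refl , b-at , v-at) =
    case tail-exit lt uL walk cover b-at v-at of λ where
      (X , p , y , Y , eqM , X≤j , p-at , y-at) →
        let eqL : b ∷ M ++ [ v ] ≡ (b ∷ X ++ [ p ]) ++ y ∷ Y
            eqL = cong (b ∷_) (trans eqM (sym (++-assoc X [ p ] (y ∷ Y))))
            uL′ : Unique ((b ∷ X ++ [ p ]) ++ y ∷ Y)
            uL′ = subst Unique eqL uL
        in case ∷ʳ-suffix (X ++ [ p ]) y Y M (sym (trans eqM (sym (++-assoc X [ p ] (y ∷ Y))))) of λ where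
          (Y₀ , eqY) →
            case tail-return (Unique-++⁻ʳ (b ∷ X ++ [ p ]) uL′) (walk-++⁻ʳ (b ∷ X ++ [ p ]) (subst IsWalk eqL walk))
                   (Unique-++⇒disjoint (b ∷ X ++ [ p ]) uL′ (there (∈-++⁺ʳ X (here refl)))) eqY p-at y-at v-at of λ where
              (Z₁ , q , eqZ , Z>j , q-at) →
                let Z : List V
                    Z = y ∷ Z₁ ++ [ q ]
                    eqL′ : b ∷ M ++ [ v ] ≡ b ∷ X ++ p ∷ Z ++ [ v ]
                    eqL′ = cong (b ∷_) (trans eqM (cong (λ ys → X ++ p ∷ ys) eqZ))
                in b , X , p , Z , v , eqL′ , b-at , p-at , v-at ,
                   tail-assemble X Z (subst Unique eqL′ uL) (subst IsWalk eqL′ walk)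
                     (λ z → subst (λ L → z ∈ L ⇔ j ≤ blockNo z) eqL′ (cover z)) b-at p-at v-at X≤j Z>j
                     (y , Z₁ , q , refl , y-at , q-at)

  tail-split-last : ∀ {L} → Tail (suc m′) L →
    ∃₂ λ b M → ∃ λ v → L ≡ b ∷ M ++ [ v ] × At (suc m′) 2 b × At (suc m′) 0 v × Enumeration LastInterior M
  tail-split-last (uL , _ , cover , b , M , v , refl , b-at , v-at) =
    b , M , v , refl , b-at , v-at , Unique-++⁻ˡ M u₁ , λ z → mk⇔ (M⇒interior z) (interior⇒M z)
    where
      u₁ : Unique (M ++ [ v ])
      u₁ = Unique-++⁻ʳ [ b ] uL
      M⇒interior : ∀ z → z ∈ M → LastInterior z
      M⇒interior z z∈M with ≤-antisym (≤-pred (blockNo<m z)) (to (cover z) (there (∈-++⁺ˡ z∈M))) | posNo-cases z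
      ... | z-last | inj₁ z0 = ⊥-elim (Unique-++⇒disjoint M u₁ z∈M (here (At-unique (z-last , z0) v-at)))
      ... | z-last | inj₂ (inj₁ z1) = z-last , inj₁ z1
      ... | z-last | inj₂ (inj₂ (inj₁ z2)) =
        ⊥-elim (Unique.Unique[x∷xs]⇒x∉xs uL (subst (_∈ M ++ [ v ]) (At-unique (z-last , z2) b-at) (∈-++⁺ˡ z∈M)))
      ... | z-last | inj₂ (inj₂ (inj₂ z≥3)) = z-last , inj₂ z≥3
      interior⇒M : ∀ z → LastInterior z → z ∈ M
      interior⇒M z (z-last , z-pos) with from (cover z) (≤-reflexive (sym z-last))
      ... | here refl = ⊥-elim (not-b z-pos (proj₂ b-at))
        where
          not-b : ∀ {x} → x ≡ 1 ⊎ 3 ≤ x → x ≢ 2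
          not-b (inj₁ refl) ()
          not-b (inj₂ x≥3) refl = <⇒≱ (s≤s (s≤s (s≤s z≤n))) x≥3
      ... | there z∈ with ∈-++⁻ M z∈
      ...   | inj₁ z∈M = z∈M
      ...   | inj₂ (here refl) = ⊥-elim (not-v z-pos (proj₂ v-at))
        where
          not-v : ∀ {x} → x ≡ 1 ⊎ 3 ≤ x → x ≢ 0
          not-v (inj₁ refl) ()
          not-v (inj₂ x≥3) refl = <⇒≱ (s≤s z≤n) x≥3

  stays-beyond-first-block : ∀ X {y Y} → Unique (v₀ ∷ X ++ a₀ ∷ y ∷ Y) → IsWalk (y ∷ Y) → At 1 2 y →
                             All (λ z → 0 < blockNo z) (y ∷ Y)
  stays-beyond-first-block X {y} {Y} uL walk y-at =
    case All.all? (λ z → 0 <? blockNo z) (y ∷ Y) of λ where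
      (yes Y>0) → Y>0
      (no ¬Y>0) → case first-entry 0 walk (≤-reflexive (sym (proj₁ y-at))) ¬Y>0 of λ where
        (Z , q , t , T , eqY , _ , cut) → ⊥-elim (returns (subst (t ∈_) (sym eqY) (∈-++⁺ʳ Z (there (here refl)))) cut)
    where
      returns : ∀ {t q} → t ∈ y ∷ Y → ¬ CutEdge 0 t q
      returns t∈ (inj₁ (t-at , _)) =
        Unique.Unique[x∷xs]⇒x∉xs uL (∈-++⁺ʳ X (there (subst (_∈ y ∷ Y) (At-unique t-at (At-v zero)) t∈)))
      returns t∈ (inj₂ (t-at , _)) =
        Unique⇒∉-delete X (y ∷ Y) (Unique-++⁻ʳ [ v₀ ] uL) (∈-++⁺ʳ X (subst (_∈ y ∷ Y) (At-unique t-at (At-a zero)) t∈))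

  leave-first-block : ∀ {R} → Unique (v₀ ∷ R) → IsWalk (v₀ ∷ R) → (∀ z → z ∈ v₀ ∷ R) →
    ¬ (∃ λ Y → R ≡ v₁ ∷ Y) →
    ∃₂ λ X y → ∃ λ Y → R ≡ X ++ a₀ ∷ y ∷ Y
      × All (λ z → blockNo z ≤ 0) X × At 1 2 y × All (λ z → 0 < blockNo z) (y ∷ Y)
  leave-first-block {R} uL walk cover ¬starts-v₁ =
    case first-exit 0 walk (≤-reflexive (proj₁ (At-v zero))) leaves of λ where
      (X₀ , p , y , Y , eq , _ , inj₁ (p-at , y-at)) →
        case Unique⇒consecutive-head uL (X₀ , Y , subst (λ u → v₀ ∷ R ≡ X₀ ++ u ∷ y ∷ Y) (At-unique p-at (At-v zero)) eq) of λ where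
          (R′ , eqR′) → ⊥-elim (¬starts-v₁ (R′ , trans eqR′ (cong (_∷ R′) (At-unique y-at (At-v (suc zero))))))
      ([] , p , y , Y , eq , _ , inj₂ (p-at , _)) →
        ⊥-elim (0≢1+n (trans (sym (proj₂ (At-v zero))) (trans (cong posNo (∷-injectiveˡ eq)) (proj₂ p-at))))
      (_ ∷ X , p , y , Y , eq , _ ∷ Xp≤0 , inj₂ (p-at , y-at)) →
        let eqR : R ≡ X ++ a₀ ∷ y ∷ Y
            eqR = subst (λ u → R ≡ X ++ u ∷ y ∷ Y) (At-unique p-at (At-a zero)) (∷-injectiveʳ eq)
            eqL : v₀ ∷ R ≡ (v₀ ∷ X ++ [ a₀ ]) ++ y ∷ Y
            eqL = cong (v₀ ∷_) (trans eqR (sym (++-assoc X [ a₀ ] (y ∷ Y))))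
        in X , y , Y , eqR , All.++⁻ˡ X Xp≤0 , y-at ,
           stays-beyond-first-block X (subst Unique (cong (v₀ ∷_) eqR) uL)
             (walk-++⁻ʳ (v₀ ∷ X ++ [ a₀ ]) (subst IsWalk eqL walk)) y-at
    where
      leaves : ¬ All (λ z → blockNo z ≤ 0) (v₀ ∷ R)
      leaves all = 1+n≰n (subst (_≤ 0) (proj₁ (At-v (suc zero))) (All.lookup all (cover v₁)))

  hamPath-assemble : ∀ X {y Y} → let L = v₀ ∷ X ++ a₀ ∷ y ∷ Y in
    Unique L → IsWalk L → (∀ z → z ∈ L) → All (λ z → blockNo z ≤ 0) X → At 1 2 y →
    All (λ z → 0 < blockNo z) (y ∷ Y) → (∃ λ Y₀ → y ∷ Y ≡ Y₀ ++ [ v₁ ]) →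
    Enumeration FirstInterior X × Tail 1 (y ∷ Y)
  hamPath-assemble X {y} {Y} uL walk cover X≤0 y-at Y>0 (Y₀ , eqY) =
    (Unique-++⁻ˡ X uR , λ z → mk⇔ (X⇒interior z) (interior⇒X z)) ,
    (Unique-++⁻ʳ (a₀ ∷ []) (Unique-++⁻ʳ X uR) , walk-++⁻ʳ (a₀ ∷ []) (walk-++⁻ʳ (v₀ ∷ X) walk) ,
     (λ z → mk⇔ (All.lookup Y>0) (beyond⇒Y z)) , ends-at-v₁ Y₀ eqY)
    where
      uR : Unique (X ++ a₀ ∷ y ∷ Y)
      uR = Unique-++⁻ʳ [ v₀ ] uL
      ends-at-v₁ : ∀ Y₀ → y ∷ Y ≡ Y₀ ++ [ v₁ ] → ∃₂ λ b M → ∃ λ v → y ∷ Y ≡ b ∷ M ++ [ v ] × At 1 2 b × At 1 0 v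
      ends-at-v₁ [] eq =
        ⊥-elim (0≢1+n (trans (sym (proj₂ (At-v (suc zero)))) (trans (cong posNo (sym (∷-injectiveˡ eq))) (proj₂ y-at))))
      ends-at-v₁ (y′ ∷ Z) eq = y′ , Z , v₁ , eq , subst (At 1 2) (∷-injectiveˡ eq) y-at , At-v (suc zero)
      X-block : ∀ {z} → z ∈ X → blockNo z ≡ 0
      X-block z∈X = n≤0⇒n≡0 (All.lookup X≤0 z∈X)
      X⇒interior : ∀ z → z ∈ X → FirstInterior z
      X⇒interior z z∈X with posNo-cases z
      ... | inj₁ z0 = ⊥-elim (Unique.Unique[x∷xs]⇒x∉xs uL
                        (subst (_∈ X ++ a₀ ∷ y ∷ Y) (At-unique (X-block z∈X , z0) (At-v zero)) (∈-++⁺ˡ z∈X)))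
      ... | inj₂ (inj₁ z1) = ⊥-elim (Unique-++⇒disjoint X uR z∈X (here (At-unique (X-block z∈X , z1) (At-a zero))))
      ... | inj₂ (inj₂ (inj₁ z2)) = X-block z∈X , ≤-reflexive (sym z2)
      ... | inj₂ (inj₂ (inj₂ z≥3)) = X-block z∈X , ≤-trans (n≤1+n 2) z≥3
      interior⇒X : ∀ z → FirstInterior z → z ∈ X
      interior⇒X z (z0 , z≥2) with ∈-four-parts X (y ∷ Y) (cover z)
      ... | inj₁ refl = ⊥-elim (<⇒≱ (s≤s z≤n) (subst (2 ≤_) (proj₂ (At-v zero)) z≥2))
      ... | inj₂ (inj₁ z∈X) = z∈X
      ... | inj₂ (inj₂ (inj₁ refl)) = ⊥-elim (<⇒≱ (s≤s (s≤s z≤n)) (subst (2 ≤_) (proj₂ (At-a zero)) z≥2))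
      ... | inj₂ (inj₂ (inj₂ z∈Y)) = ⊥-elim (<-irrefl (sym z0) (All.lookup Y>0 z∈Y))
      beyond⇒Y : ∀ z → 1 ≤ blockNo z → z ∈ y ∷ Y
      beyond⇒Y z z>0 with ∈-four-parts X (y ∷ Y) (cover z)
      ... | inj₁ refl = ⊥-elim (<-irrefl (sym (proj₁ (At-v zero))) z>0)
      ... | inj₂ (inj₁ z∈X) = ⊥-elim (<-irrefl (sym (X-block z∈X)) z>0)
      ... | inj₂ (inj₂ (inj₁ refl)) = ⊥-elim (<-irrefl (sym (proj₁ (At-a zero))) z>0)
      ... | inj₂ (inj₂ (inj₂ z∈Y)) = z∈Y

  hamPath-split : ∀ {L} → HamPath L → ∃₂ λ X Y → L ≡ v₀ ∷ X ++ a₀ ∷ Y × Enumeration FirstInterior X × Tail 1 Y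
  hamPath-split h@(uL , walk , cover , M , refl) =
    case leave-first-block uL walk cover ¬starts-v₁ of λ where
      (X , y , Y , eqR , X≤0 , y-at , Y>0) →
        let eqL : v₀ ∷ M ++ [ v₁ ] ≡ v₀ ∷ X ++ a₀ ∷ y ∷ Y
            eqL = cong (v₀ ∷_) eqR
        in X , y ∷ Y , eqL ,
           hamPath-assemble X (subst Unique eqL uL) (subst IsWalk eqL walk) (λ z → subst (z ∈_) eqL (cover z)) X≤0 y-at Y>0
             (∷ʳ-suffix (X ++ [ a₀ ]) y Y M (sym (trans eqR (sym (++-assoc X [ a₀ ] (y ∷ Y))))))
    where
      ¬starts-v₁ : ¬ (∃ λ Y → M ++ [ v₁ ] ≡ v₁ ∷ Y)
      ¬starts-v₁ (Y , eq) = hamPath-middle≢[] h (proj₁ (Unique-split-unique M [] [] Y (Unique-++⁻ʳ [ v₀ ] uL) eq))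

  tail-join : ∀ (j : Fin m) {X Z} → Enumeration (Interior (toℕ j)) X → Tail (suc (toℕ j)) Z →
                Tail (toℕ j) (b[ j ] ∷ X ++ a[ j ] ∷ Z ++ [ v[ j ] ])
  tail-join j {X} (uX , X⇔) (uZ , walkZ , coverZ , b′ , Z₁ , v′ , refl , b′-at , v′-at) =
    subst Unique eqL uL , subst IsWalk eqL walk , (λ z → subst (λ L → z ∈ L ⇔ i ≤ blockNo z) eqL (cover z)) ,
    b[ j ] , X ++ a[ j ] ∷ Z , v[ j ] , cong (b[ j ] ∷_) (sym (++-assoc X (a[ j ] ∷ Z) [ v[ j ] ])) , At-b j , At-v j
    where
      i : ℕ
      i = toℕ j
      Z S T : List V
      Z = b′ ∷ Z₁ ++ [ v′ ]
      S = b[ j ] ∷ X ++ [ a[ j ] ]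
      T = Z ++ [ v[ j ] ]
      eqL : S ++ T ≡ b[ j ] ∷ X ++ a[ j ] ∷ Z ++ [ v[ j ] ]
      eqL = cong (b[ j ] ∷_) (++-assoc X [ a[ j ] ] T)
      X-interior : ∀ {z} → z ∈ X → Interior i z
      X-interior {z} = to (X⇔ z)
      S-block : ∀ {z} → z ∈ S → blockNo z ≡ i × posNo z ≢ 0
      S-block (here refl) = proj₁ (At-b j) , λ p0 → 0≢1+n (trans (sym p0) (proj₂ (At-b j)))
      S-block (there z∈) with ∈-++⁻ X z∈
      ... | inj₁ z∈X = proj₁ (X-interior z∈X) , λ p0 → <⇒≱ (s≤s z≤n) (subst (3 ≤_) p0 (proj₂ (X-interior z∈X)))
      ... | inj₂ (here refl) = proj₁ (At-a j) , λ p0 → 0≢1+n (trans (sym p0) (proj₂ (At-a j)))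
      Z-block : ∀ {z} → z ∈ Z → i < blockNo z
      Z-block {z} = to (coverZ z)
      uS : Unique S
      uS = Unique-∷⁺ b∉ (Unique-++⁺ uX ([] ∷ []) λ { z∈X (here refl) → a∉X z∈X })
        where
          a∉X : a[ j ] ∉ X
          a∉X a∈X = <⇒≱ (s≤s (s≤s z≤n)) (subst (3 ≤_) (proj₂ (At-a j)) (proj₂ (X-interior a∈X)))
          b∉ : b[ j ] ∉ X ++ [ a[ j ] ]
          b∉ b∈ with ∈-++⁻ X b∈
          ... | inj₁ b∈X = <⇒≱ (s≤s (s≤s (s≤s z≤n))) (subst (3 ≤_) (proj₂ (At-b j)) (proj₂ (X-interior b∈X)))
          ... | inj₂ (here eq) = 0≢1+n (suc-injective (trans (sym (proj₂ (At-a j))) (trans (cong posNo (sym eq)) (proj₂ (At-b j)))))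
      uT : Unique T
      uT = Unique-++⁺ uZ ([] ∷ []) λ { v∈Z (here refl) → <-irrefl (sym (proj₁ (At-v j))) (Z-block v∈Z) }
      uL : Unique (S ++ T)
      uL = Unique-++⁺ uS uT disjoint
        where
          disjoint : ∀ {z} → z ∈ S → z ∉ T
          disjoint z∈S z∈T with S-block z∈S | ∈-++⁻ Z z∈T
          ... | z-i , _   | inj₁ z∈Z = <-irrefl (sym z-i) (Z-block z∈Z)
          ... | _ , z≢0   | inj₂ (here refl) = z≢0 (proj₂ (At-v j))
      walkS : IsWalk S
      walkS = walk-inBlock uS (All.tabulate (proj₁ ∘ S-block))
        λ c → positions≢0⇒¬deleted (proj₂ (S-block (proj₁ (consecutive-∈ c)))) (proj₂ (S-block (proj₂ (consecutive-∈ c))))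
      walkT : IsWalk T
      walkT = walk-++⁺ walkZ walk-[ v[ j ] ] λ jn → case (junction-∷ʳ (b′ ∷ Z₁) jn)
        where
          case : ∀ {u w} → u ≡ v′ × w ≡ v[ j ] → Adj u w
          case (refl , refl) = adj-sym {v[ j ]} {v′} (cutEdge⇒adj (inj₁ (At-v j , v′-at)))
      walk : IsWalk (S ++ T)
      walk = walk-++⁺ walkS walkT λ jn → case (junction-∷ʳ (b[ j ] ∷ X) jn)
        where
          case : ∀ {u w} → u ≡ a[ j ] × w ≡ b′ → Adj u w
          case (refl , refl) = cutEdge⇒adj (inj₂ (At-a j , b′-at))
      cover : ∀ z → z ∈ S ++ T ⇔ i ≤ blockNo z
      cover z = mk⇔ to′ from′
        where
          to′ : z ∈ S ++ T → i ≤ blockNo z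
          to′ z∈ with ∈-++⁻ S z∈
          ... | inj₁ z∈S = ≤-reflexive (sym (proj₁ (S-block z∈S)))
          ... | inj₂ z∈T with ∈-++⁻ Z z∈T
          ...   | inj₁ z∈Z = <⇒≤ (Z-block z∈Z)
          ...   | inj₂ (here refl) = ≤-reflexive (sym (proj₁ (At-v j)))
          from′ : i ≤ blockNo z → z ∈ S ++ T
          from′ i≤z with m≤n⇒m<n∨m≡n i≤z
          ... | inj₁ i<z = ∈-++⁺ʳ S (∈-++⁺ˡ (from (coverZ z) i<z))
          ... | inj₂ i≡z with posNo-cases z
          ...   | inj₁ z0 = ∈-++⁺ʳ S (∈-++⁺ʳ Z (here (At-unique (sym i≡z , z0) (At-v j))))
          ...   | inj₂ (inj₁ z1) = ∈-++⁺ˡ (there (∈-++⁺ʳ X (here (At-unique (sym i≡z , z1) (At-a j)))))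
          ...   | inj₂ (inj₂ (inj₁ z2)) = here (At-unique (sym i≡z , z2) (At-b j))
          ...   | inj₂ (inj₂ (inj₂ z≥3)) = ∈-++⁺ˡ (there (∈-++⁺ˡ (from (X⇔ z) (sym i≡z , z≥3))))

  tail-join-last : ∀ {M} → Enumeration LastInterior M → Tail (suc m′) (b[ last ] ∷ M ++ [ v[ last ] ])
  tail-join-last {M} (uM , M⇔) = uL , walk , cover , b[ last ] , M , v[ last ] , refl , b-at , v-at
    where
      L : List V
      L = b[ last ] ∷ M ++ [ v[ last ] ]
      b-at : At (suc m′) 2 b[ last ]
      b-at = At-last (At-b last)
      a-at : At (suc m′) 1 a[ last ]
      a-at = At-last (At-a last)
      v-at : At (suc m′) 0 v[ last ]
      v-at = At-last (At-v last)
      M-pos : ∀ {z} → z ∈ M → posNo z ≢ 0 × posNo z ≢ 2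
      M-pos {z} z∈M with proj₂ (to (M⇔ z) z∈M)
      ... | inj₁ z1 = (λ z0 → 0≢1+n (trans (sym z0) z1)) , (λ z2 → 0≢1+n (suc-injective (trans (sym z1) z2)))
      ... | inj₂ z≥3 = (λ z0 → <⇒≱ (s≤s z≤n) (subst (3 ≤_) z0 z≥3)) ,
                       (λ z2 → <⇒≱ (s≤s (s≤s (s≤s z≤n))) (subst (3 ≤_) z2 z≥3))
      uL : Unique L
      uL = Unique-∷⁺ b∉ (Unique-++⁺ uM ([] ∷ []) λ { z∈M (here refl) → proj₁ (M-pos z∈M) (proj₂ v-at) })
        where
          b∉ : b[ last ] ∉ M ++ [ v[ last ] ]
          b∉ b∈ with ∈-++⁻ M b∈
          ... | inj₁ b∈M = proj₂ (M-pos b∈M) (proj₂ b-at)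
          ... | inj₂ (here eq) = 0≢1+n (trans (sym (proj₂ v-at)) (trans (cong posNo (sym eq)) (proj₂ b-at)))
      L-block : ∀ {z} → z ∈ L → blockNo z ≡ suc m′
      L-block (here refl) = proj₁ b-at
      L-block (there z∈) with ∈-++⁻ M z∈
      ... | inj₁ z∈M = proj₁ (to (M⇔ _) z∈M)
      ... | inj₂ (here refl) = proj₁ v-at
      L-pos0 : ∀ {z} → z ∈ L → posNo z ≡ 0 → z ≡ v[ last ]
      L-pos0 z∈ z0 = At-unique (L-block z∈ , z0) v-at
      L-pos2 : ∀ {z} → z ∈ L → posNo z ≡ 2 → z ≡ b[ last ]
      L-pos2 z∈ z2 = At-unique (L-block z∈ , z2) b-at
      M≢[] : M ≢ []
      M≢[] refl = Any.¬Any[] (from (M⇔ a[ last ]) (proj₁ a-at , inj₁ (proj₂ a-at)))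
      walk : IsWalk L
      walk = walk-inBlock-ends uL M≢[] (All.tabulate L-block) ends
        where
          ends : ∀ {u w} → u ∈ L → w ∈ L → Deletedℕ (suc m′) (posNo u) (posNo w) →
                 (u ≡ b[ last ] × w ≡ v[ last ]) ⊎ (u ≡ v[ last ] × w ≡ b[ last ])
          ends u∈ w∈ (inj₁ (_ , lt)) = ⊥-elim (<-irrefl refl lt)
          ends u∈ w∈ (inj₂ (inj₁ (u0 , w2) , _)) = inj₂ (L-pos0 u∈ u0 , L-pos2 w∈ w2)
          ends u∈ w∈ (inj₂ (inj₂ (u2 , w0) , _)) = inj₁ (L-pos2 u∈ u2 , L-pos0 w∈ w0)
      cover : ∀ z → z ∈ L ⇔ suc m′ ≤ blockNo z
      cover z = mk⇔ (≤-reflexive ∘ sym ∘ L-block) from′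
        where
          from′ : suc m′ ≤ blockNo z → z ∈ L
          from′ z≥ with ≤-antisym (≤-pred (blockNo<m z)) z≥ | posNo-cases z
          ... | z-last | inj₁ z0 = there (∈-++⁺ʳ M (here (At-unique (z-last , z0) v-at)))
          ... | z-last | inj₂ (inj₁ z1) = there (∈-++⁺ˡ (from (M⇔ z) (z-last , inj₁ z1)))
          ... | z-last | inj₂ (inj₂ (inj₁ z2)) = here (At-unique (z-last , z2) b-at)
          ... | z-last | inj₂ (inj₂ (inj₂ z≥3)) = there (∈-++⁺ˡ (from (M⇔ z) (z-last , inj₂ z≥3)))

  hamPath-join : ∀ {X Y} → Enumeration FirstInterior X → Tail 1 Y → HamPath (v₀ ∷ X ++ a₀ ∷ Y)
  hamPath-join {X} (uX , X⇔) (uY , walkY , coverY , b′ , M′ , v′ , refl , b′-at , v′-at) =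
    subst Unique eqL uL , subst IsWalk eqL walk , (λ z → subst (z ∈_) eqL (cover z)) ,
    X ++ a₀ ∷ b′ ∷ M′ , shape
    where
      Y S : List V
      Y = b′ ∷ M′ ++ [ v′ ]
      S = v₀ ∷ X ++ [ a₀ ]
      eqL : S ++ Y ≡ v₀ ∷ X ++ a₀ ∷ Y
      eqL = cong (v₀ ∷_) (++-assoc X [ a₀ ] Y)
      shape : v₀ ∷ X ++ a₀ ∷ Y ≡ v₀ ∷ (X ++ a₀ ∷ b′ ∷ M′) ++ [ v₁ ]
      shape = cong (v₀ ∷_) (trans (cong (λ u → X ++ a₀ ∷ b′ ∷ M′ ++ [ u ]) (At-unique v′-at (At-v (suc zero))))
                                  (sym (++-assoc X (a₀ ∷ b′ ∷ M′) [ v₁ ])))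
      X-pos : ∀ {z} → z ∈ X → 2 ≤ posNo z
      X-pos {z} = proj₂ ∘ to (X⇔ z)
      S-block : ∀ {z} → z ∈ S → blockNo z ≡ 0
      S-block (here refl) = proj₁ (At-v zero)
      S-block (there z∈) with ∈-++⁻ X z∈
      ... | inj₁ z∈X = proj₁ (to (X⇔ _) z∈X)
      ... | inj₂ (here refl) = proj₁ (At-a zero)
      S-pos0 : ∀ {z} → z ∈ S → posNo z ≡ 0 → z ≡ v₀
      S-pos0 z∈ z0 = At-unique (S-block z∈ , z0) (At-v zero)
      S-pos1 : ∀ {z} → z ∈ S → posNo z ≡ 1 → z ≡ a₀
      S-pos1 z∈ z1 = At-unique (S-block z∈ , z1) (At-a zero)
      uS : Unique S
      uS = Unique-∷⁺ v∉ (Unique-++⁺ uX ([] ∷ [])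
        λ { a∈X (here refl) → <⇒≱ (s≤s (s≤s z≤n)) (subst (2 ≤_) (proj₂ (At-a zero)) (X-pos a∈X)) })
        where
          v∉ : v₀ ∉ X ++ [ a₀ ]
          v∉ v∈ with ∈-++⁻ X v∈
          ... | inj₁ v∈X = <⇒≱ (s≤s z≤n) (subst (2 ≤_) (proj₂ (At-v zero)) (X-pos v∈X))
          ... | inj₂ (here eq) = 0≢1+n (trans (sym (proj₂ (At-v zero))) (trans (cong posNo eq) (proj₂ (At-a zero))))
      uL : Unique (S ++ Y)
      uL = Unique-++⁺ uS uY λ z∈S z∈Y → <-irrefl (sym (S-block z∈S)) (to (coverY _) z∈Y)
      X≢[] : X ≢ []
      X≢[] refl = Any.¬Any[] (from (X⇔ b[ zero ]) (proj₁ (At-b zero) , ≤-reflexive (sym (proj₂ (At-b zero)))))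
      walkS : IsWalk S
      walkS = walk-inBlock-ends uS X≢[] (All.tabulate S-block) ends
        where
          ends : ∀ {u w} → u ∈ S → w ∈ S → Deletedℕ 0 (posNo u) (posNo w) →
                 (u ≡ v₀ × w ≡ a₀) ⊎ (u ≡ a₀ × w ≡ v₀)
          ends u∈ w∈ (inj₁ (inj₁ (u0 , w1) , _)) = inj₁ (S-pos0 u∈ u0 , S-pos1 w∈ w1)
          ends u∈ w∈ (inj₁ (inj₂ (u1 , w0) , _)) = inj₂ (S-pos1 u∈ u1 , S-pos0 w∈ w0)
          ends u∈ w∈ (inj₂ (_ , ()))
      walk : IsWalk (S ++ Y)
      walk = walk-++⁺ walkS walkY λ jn → case (junction-∷ʳ (v₀ ∷ X) jn)
        where
          case : ∀ {u w} → u ≡ a₀ × w ≡ b′ → Adj u w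
          case (refl , refl) = cutEdge⇒adj (inj₂ (At-a zero , b′-at))
      cover : ∀ z → z ∈ S ++ Y
      cover z with blockNo z ≟ 0
      ... | no z≢0 = ∈-++⁺ʳ S (from (coverY z) (n≢0⇒n>0 z≢0))
      ... | yes z0 with posNo-cases z
      ...   | inj₁ p0 = here (At-unique (z0 , p0) (At-v zero))
      ...   | inj₂ (inj₁ p1) = there (∈-++⁺ˡ (∈-++⁺ʳ X (here (At-unique (z0 , p1) (At-a zero)))))
      ...   | inj₂ (inj₂ (inj₁ p2)) = there (∈-++⁺ˡ (∈-++⁺ˡ (from (X⇔ z) (z0 , ≤-reflexive (sym p2)))))
      ...   | inj₂ (inj₂ (inj₂ p≥3)) = there (∈-++⁺ˡ (∈-++⁺ˡ (from (X⇔ z) (z0 , ≤-trans (n≤1+n 2) p≥3))))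

  HasSize-inBlock : ∀ (j : Fin m) {Q : ℕ → Set} {c} → HasSize (λ (x : Fin (suc k)) → Q (toℕ x)) c →
                    HasSize (λ z → blockNo z ≡ toℕ j × Q (posNo z)) c
  HasSize-inBlock j {Q} size = HasSize-map (vertex j) size (λ _ _ eq → proj₂ (combine-injective j _ j _ eq)) iff
    where
      iff : ∀ z → (blockNo z ≡ toℕ j × Q (posNo z)) ⇔ (∃ λ x → Q (toℕ x) × vertex j x ≡ z)
      iff z = mk⇔
        (λ (z-j , q) → let (z≡ , posNo≡) = blockNo≡toℕ⇒vertex j z-j in pos z , subst Q posNo≡ q , sym z≡)
        (λ { (x , q , refl) → blockNo-vertex j x , subst Q (sym (posNo-vertex j x)) q })

  interior-size : ∀ j → HasSize (Interior (toℕ j)) (suc k′)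
  interior-size j = HasSize-inBlock j {3 ≤_} (HasSize-≥ 3 (suc k′))

  firstInterior-size : HasSize FirstInterior (suc (suc k′))
  firstInterior-size = HasSize-inBlock zero {2 ≤_} (HasSize-≥ 2 (suc (suc k′)))

  lastInterior-size : HasSize LastInterior (suc (suc k′))
  lastInterior-size =
    HasSize-⇔ (HasSize-inBlock last {λ x → x ≡ 1 ⊎ 3 ≤ x} (HasSize-⊎ one (HasSize-≥ 3 (suc k′)) one-≱3))
      (λ z → mk⇔ (λ (z-last , p) → trans z-last (toℕ-fromℕ (suc m′)) , p)
                 (λ (z-last , p) → trans z-last (sym (toℕ-fromℕ (suc m′))) , p))
    where
      one : HasSize (λ (x : Fin (suc k)) → toℕ x ≡ 1) 1
      one = HasSize-⇔ (HasSize-singleton (suc zero)) (λ x → mk⇔ (cong toℕ) toℕ-injective)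
      one-≱3 : ∀ (x : Fin (suc k)) → toℕ x ≡ 1 → ¬ 3 ≤ toℕ x
      one-≱3 x x1 x≥3 = <⇒≱ (s≤s (s≤s z≤n)) (subst (3 ≤_) x1 x≥3)

  tail-count-last : HasSize (Tail (suc m′)) (suc (suc k′) !)
  tail-count-last = HasSize-map (λ M → b[ last ] ∷ M ++ [ v[ last ] ]) (enumerations-count lastInterior-size)
    (λ _ _ eq → ∷ʳ-injectiveˡ _ _ (∷-injectiveʳ eq)) iff
    where
      iff : ∀ L → Tail (suc m′) L ⇔ (∃ λ M → Enumeration LastInterior M × b[ last ] ∷ M ++ [ v[ last ] ] ≡ L)
      iff L = mk⇔ to′ (λ { (M , e , refl) → tail-join-last e })
        where
          to′ : Tail (suc m′) L → ∃ λ M → Enumeration LastInterior M × b[ last ] ∷ M ++ [ v[ last ] ] ≡ L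
          to′ t with tail-split-last t
          ... | b , M , v , refl , b-at , v-at , e =
            M , e , cong₂ (λ b v → b ∷ M ++ [ v ])
                      (At-unique (At-last (At-b last)) b-at)
                      (At-unique (At-last (At-v last)) v-at)

  tail-count : ∀ d (j : Fin m) → toℕ j + d ≡ suc m′ → HasSize (Tail (toℕ j)) ((suc k′ !) ^ d * suc (suc k′) !)
  tail-count zero j eq =
    subst₂ (λ i c → HasSize (Tail i) c) (trans (sym eq) (+-identityʳ (toℕ j))) (sym (*-identityˡ _)) tail-count-last
  tail-count (suc d) j eq =
    subst (HasSize (Tail (toℕ j))) (sym (*-assoc (suc k′ !) ((suc k′ !) ^ d) (suc (suc k′) !)))
      (HasSize-map₂ (λ X Z → b[ j ] ∷ X ++ a[ j ] ∷ Z ++ [ v[ j ] ]) (enumerations-count (interior-size j)) IH inj iff)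
    where
      eq′ : suc (toℕ j) + d ≡ suc m′
      eq′ = trans (sym (+-suc (toℕ j) d)) eq
      lt : suc (toℕ j) < m
      lt = s≤s (subst (suc (toℕ j) ≤_) eq′ (m≤m+n (suc (toℕ j)) d))
      IH : HasSize (Tail (suc (toℕ j))) ((suc k′ !) ^ d * suc (suc k′) !)
      IH = subst (λ i → HasSize (Tail i) ((suc k′ !) ^ d * suc (suc k′) !)) (toℕ-fromℕ< lt)
             (tail-count d (fromℕ< lt) (trans (cong (_+ d) (toℕ-fromℕ< lt)) eq′))
      inj : ∀ {X Z X′ Z′} → Enumeration (Interior (toℕ j)) X → Tail (suc (toℕ j)) Z →
            Enumeration (Interior (toℕ j)) X′ → Tail (suc (toℕ j)) Z′ →
            b[ j ] ∷ X ++ a[ j ] ∷ Z ++ [ v[ j ] ] ≡ b[ j ] ∷ X′ ++ a[ j ] ∷ Z′ ++ [ v[ j ] ] → X ≡ X′ × Z ≡ Z′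
      inj {X} {Z} {X′} {Z′} e _ e′ _ eqL
        with ++-cancel-length X X′ (trans (Enumeration-length (interior-size j) e) (sym (Enumeration-length (interior-size j) e′)))
               (∷-injectiveʳ eqL)
      ... | refl , eqR = refl , ∷ʳ-injectiveˡ Z Z′ (∷-injectiveʳ eqR)
      iff : ∀ L → Tail (toℕ j) L ⇔ (∃₂ λ X Z → Enumeration (Interior (toℕ j)) X × Tail (suc (toℕ j)) Z ×
                                               b[ j ] ∷ X ++ a[ j ] ∷ Z ++ [ v[ j ] ] ≡ L)
      iff L = mk⇔ to′ (λ { (X , Z , e , t , refl) → tail-join j e t })
        where
          to′ : Tail (toℕ j) L → ∃₂ λ X Z → Enumeration (Interior (toℕ j)) X × Tail (suc (toℕ j)) Z ×
                                             b[ j ] ∷ X ++ a[ j ] ∷ Z ++ [ v[ j ] ] ≡ L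
          to′ t with tail-split lt t
          ... | b , X , p , Z , v , refl , b-at , p-at , v-at , e , t′ =
            X , Z , e , t′ ,
            cong₂ (λ b rest → b ∷ X ++ rest) (At-unique (At-b j) b-at)
              (cong₂ (λ p v → p ∷ Z ++ [ v ]) (At-unique (At-a j) p-at) (At-unique (At-v j) v-at))

  hamPath-count : HasSize HamPath (suc (suc k′) ! * ((suc k′ !) ^ m′ * suc (suc k′) !))
  hamPath-count =
    HasSize-map₂ (λ X Y → v₀ ∷ X ++ a₀ ∷ Y) (enumerations-count firstInterior-size) (tail-count m′ (suc zero) refl) inj iff
    where
      inj : ∀ {X Y X′ Y′} → Enumeration FirstInterior X → Tail 1 Y → Enumeration FirstInterior X′ → Tail 1 Y′ →
            v₀ ∷ X ++ a₀ ∷ Y ≡ v₀ ∷ X′ ++ a₀ ∷ Y′ → X ≡ X′ × Y ≡ Y′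
      inj {X} {Y} {X′} {Y′} e _ e′ _ eqL with
        ++-cancel-length X X′ (trans (Enumeration-length firstInterior-size e) (sym (Enumeration-length firstInterior-size e′)))
          (∷-injectiveʳ eqL)
      ... | refl , eqR = refl , ∷-injectiveʳ eqR
      iff : ∀ L → HamPath L ⇔ (∃₂ λ X Y → Enumeration FirstInterior X × Tail 1 Y × v₀ ∷ X ++ a₀ ∷ Y ≡ L)
      iff L = mk⇔ to′ (λ { (X , Y , e , t , refl) → hamPath-join e t })
        where
          to′ : HamPath L → ∃₂ λ X Y → Enumeration FirstInterior X × Tail 1 Y × v₀ ∷ X ++ a₀ ∷ Y ≡ L
          to′ h with hamPath-split h
          ... | X , Y , eq , e , t = X , Y , e , t , sym eq

  hamPath-length : ∀ {L} → HamPath L → length L ≡ n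
  hamPath-length (uL , _ , cover , _) =
    trans (enumeration-length (Unique.allFin⁺ n) (uL , λ z → mk⇔ (λ _ → ∈-allFin z) (λ _ → cover z)))
          (length-tabulate (λ i → i))

  hamPath-cyclicSucc⇒adj : ∀ {L} → HamPath L → ∀ {u w} → CyclicSucc L u w → Adj u w
  hamPath-cyclicSucc⇒adj (_ , walk , _ , M , refl) (inj₁ c) = walk c
  hamPath-cyclicSucc⇒adj (_ , walk , _ , M , refl) (inj₂ (C , eq))
    with ∷-injectiveˡ eq | ∷ʳ-injectiveʳ C M (sym (∷-injectiveʳ eq))
  ... | refl | refl = adj-sym {v₀} {v₁} (cutEdge⇒adj (inj₁ (At-v zero , At-v (suc zero))))

  hamPath-cyclicEdge⇒adj : ∀ {L} → HamPath L → ∀ {u w} → CyclicEdge L u w → Adj u w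
  hamPath-cyclicEdge⇒adj h (inj₁ s) = hamPath-cyclicSucc⇒adj h s
  hamPath-cyclicEdge⇒adj h {u} {w} (inj₂ s) = adj-sym {w} {u} (hamPath-cyclicSucc⇒adj h s)

  -- n reduces to suc (suc N₂).
  N₂ : ℕ
  N₂ = suc (suc (k′ + suc m′ * suc k))

  -- The default argument of nth is irrelevant: sequence L is only used when length L ≡ n.
  sequence : List V → Fin n → V
  sequence L t = nth L (toℕ t) t

  tabulate-sequence : ∀ {L} → length L ≡ n → tabulate (sequence L) ≡ L
  tabulate-sequence {L} = tabulate-nth L (λ t → t)

  cycleMatrix : List V → Subgraph
  cycleMatrix L = toMatrix (sequenceEdge? (sequence L))

  cycleMatrix-entry : ∀ {L} → length L ≡ n → ∀ u w → entry (cycleMatrix L) u w ≡ true ⇔ CyclicEdge L u w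
  cycleMatrix-entry {L} len u w =
    ⇔.trans (toMatrix-entry (sequenceEdge? (sequence L)) u w)
      (subst (λ L′ → SequenceEdge (sequence L) u w ⇔ CyclicEdge L′ u w) (tabulate-sequence len)
        (sequenceEdge⇔cyclicEdge N₂ (sequence L) u w))

  hamPath⇒hamCycle : ∀ {L} → HamPath L → IsHamCycle (cycleMatrix L)
  hamPath⇒hamCycle {L} h@(uL , _) =
    sequence L , Unique-tabulate⁻ (sequence L) (subst Unique (sym tab) uL) , adj ,
    toMatrix-entry (sequenceEdge? (sequence L))
    where
      tab : tabulate (sequence L) ≡ L
      tab = tabulate-sequence (hamPath-length h)
      adj : ∀ t s → Next t s → Adj (sequence L t) (sequence L s)
      adj t s next = hamPath-cyclicEdge⇒adj h {sequence L t} {sequence L s}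
        (subst (λ L′ → CyclicEdge L′ (sequence L t) (sequence L s)) tab
          (to (sequenceEdge⇔cyclicEdge N₂ (sequence L) (sequence L t) (sequence L s)) (t , s , next , inj₁ (refl , refl))))

  cycleMatrix-injective : ∀ {L L′} → HamPath L → HamPath L′ → cycleMatrix L ≡ cycleMatrix L′ → L ≡ L′
  cycleMatrix-injective {L} {L′} h@(uL , _ , _ , M , refl) h′@(uL′ , _ , _ , M′ , refl) eq =
    cyclicEdges-⊆⇒≡ uL uL′ (hamPath-middle≢[] h) λ {u} {w} e →
      to (cycleMatrix-entry (hamPath-length h′) u w)
        (subst (λ H → entry H u w ≡ true) eq (from (cycleMatrix-entry (hamPath-length h) u w) e))

  -- If neither neighbour of v₀ on the cycle is v₁, the cycle leaves block 0 through a₀ b₁ and can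
  -- only re-enter it through v₁ v₀.
  cycle-normalise : ∀ R → Unique (v₀ ∷ R) → (∀ z → z ∈ v₀ ∷ R) →
                    (∀ {u w} → CyclicEdge (v₀ ∷ R) u w → Adj u w) →
                    ∃ λ L → HamPath L × (∀ u w → CyclicEdge L u w ⇔ CyclicEdge (v₀ ∷ R) u w)
  cycle-normalise [] _ cover _ with cover v₁
  ... | here eq = ⊥-elim (1+n≢0 (trans (sym (proj₁ (At-v (suc zero)))) (trans (cong blockNo eq) (proj₁ (At-v zero)))))
  cycle-normalise (r ∷ R) uL cover adj with r ≟ᶠ v₁
  ... | yes refl =
    L , (uL′ , adj ∘ to (same _ _) ∘ inj₁ ∘ inj₁ , cover′ , reverse R , cong (v₀ ∷_) (unfold-reverse v₁ R)) , same
    where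
      L : List V
      L = v₀ ∷ reverse (v₁ ∷ R)
      reverse-L₀ : reverse (v₀ ∷ v₁ ∷ R) ≡ reverse (v₁ ∷ R) ++ [ v₀ ]
      reverse-L₀ = unfold-reverse v₀ (v₁ ∷ R)
      same : ∀ u w → CyclicEdge L u w ⇔ CyclicEdge (v₀ ∷ v₁ ∷ R) u w
      same u w = mk⇔
        (λ e → cyclicEdge-reverse⁻ (subst (λ L′ → CyclicEdge L′ u w) (sym reverse-L₀)
                 (cyclicEdge-rotate [ v₀ ] (reverse (v₁ ∷ R)) e)))
        (λ e → cyclicEdge-rotate (reverse (v₁ ∷ R)) [ v₀ ]
                 (subst (λ L′ → CyclicEdge L′ u w) reverse-L₀ (cyclicEdge-reverse e)))
      uL′ : Unique L
      uL′ = Unique-swap (reverse (v₁ ∷ R)) (subst Unique reverse-L₀ (Unique-reverse uL))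
      cover′ : ∀ z → z ∈ L
      cover′ z with cover z
      ... | here eq = here eq
      ... | there z∈ = there (Any.reverse⁺ z∈)
  ... | no r≢v₁ with ∷⇒∷ʳ r R
  ...   | M , w , eq with w ≟ᶠ v₁
  ...     | yes refl = v₀ ∷ r ∷ R , (uL , adj ∘ inj₁ ∘ inj₁ , cover , M , cong (v₀ ∷_) eq) , λ _ _ → ⇔.refl
  ...     | no w≢v₁ with leave-first-block uL (adj ∘ inj₁ ∘ inj₁) cover (λ (_ , eq′) → r≢v₁ (∷-injectiveˡ eq′))
  ...       | X , y , Y , eqR , _ , _ , Y>0 =
    ⊥-elim (closes (cut-edge {0} {v₀} {w} (adj-sym {w} {v₀} w-v₀) (≤-reflexive (proj₁ (At-v zero))) w>0))
    where
      w-v₀ : Adj w v₀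
      w-v₀ = adj (inj₁ (inj₂ (M , cong (v₀ ∷_) eq)))
      w>0 : 0 < blockNo w
      w>0 = All.lookup Y>0 (last∈suffix M (X ++ [ a₀ ]) (trans (sym eq) (trans eqR (sym (++-assoc X [ a₀ ] (y ∷ Y))))))
      closes : ¬ CutEdge 0 v₀ w
      closes (inj₁ (_ , w-at)) = w≢v₁ (At-unique w-at (At-v (suc zero)))
      closes (inj₂ ((_ , v₀-pos1) , _)) = 0≢1+n (trans (sym (proj₂ (At-v zero))) v₀-pos1)

  cycle⇒hamPath : ∀ L₀ → Unique L₀ → (∀ z → z ∈ L₀) → (∀ {u w} → CyclicEdge L₀ u w → Adj u w) →
                  ∃ λ L → HamPath L × (∀ u w → CyclicEdge L u w ⇔ CyclicEdge L₀ u w)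
  cycle⇒hamPath L₀ u₀ cover₀ adj₀ with ∈-∃++ (cover₀ v₀)
  ... | P , Q , refl with cycle-normalise (Q ++ P) (Unique-swap P u₀) cover₁ (adj₀ ∘ rotate _ _)
    where
      rotate : ∀ u w → CyclicEdge ((v₀ ∷ Q) ++ P) u w → CyclicEdge (P ++ v₀ ∷ Q) u w
      rotate u w = cyclicEdge-rotate (v₀ ∷ Q) P
      cover₁ : ∀ z → z ∈ v₀ ∷ Q ++ P
      cover₁ z with ∈-++⁻ P (cover₀ z)
      ... | inj₁ z∈P = ∈-++⁺ʳ (v₀ ∷ Q) z∈P
      ... | inj₂ z∈ = ∈-++⁺ˡ z∈
  ... | L , h , same = L , h , λ u w → ⇔.trans (same u w) (mk⇔ (cyclicEdge-rotate (v₀ ∷ Q) P) (cyclicEdge-rotate P (v₀ ∷ Q)))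

  tabulate-cover : ∀ (σ : Fin n → V) → (∀ {i j} → σ i ≡ σ j → i ≡ j) → ∀ z → z ∈ tabulate σ
  tabulate-cover σ σ-inj z with injective⇒surjective σ σ-inj z
  ... | t , refl = ∈-tabulate⁺ {f = σ} t

  tabulate-cyclicEdge⇒adj : ∀ (σ : Fin n → V) → (∀ t s → Next t s → Adj (σ t) (σ s)) →
                            ∀ {u w} → CyclicEdge (tabulate σ) u w → Adj u w
  tabulate-cyclicEdge⇒adj σ σ-adj {u} {w} e with from (sequenceEdge⇔cyclicEdge N₂ σ u w) e
  ... | t , s , next , inj₁ (refl , refl) = σ-adj t s next
  ... | t , s , next , inj₂ (refl , refl) = adj-sym {σ t} {σ s} (σ-adj t s next)

  cycleMatrix-≡ : ∀ {L H} (σ : Fin n → V) → HamPath L → (∀ u w → CyclicEdge L u w ⇔ CyclicEdge (tabulate σ) u w) →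
                  (∀ u w → entry H u w ≡ true ⇔ SequenceEdge σ u w) → cycleMatrix L ≡ H
  cycleMatrix-≡ {L} σ h same H⇔ = matrix-ext λ u w → mk⇔
    (λ e → from (H⇔ u w) (from (sequenceEdge⇔cyclicEdge N₂ σ u w) (to (same u w) (to (cycleMatrix-entry len u w) e))))
    (λ e → from (cycleMatrix-entry len u w) (from (same u w) (to (sequenceEdge⇔cyclicEdge N₂ σ u w) (to (H⇔ u w) e))))
    where
      len : length L ≡ n
      len = hamPath-length h

  hamCycle⇒hamPath : ∀ {H} → IsHamCycle H → ∃ λ L → HamPath L × cycleMatrix L ≡ H
  hamCycle⇒hamPath {H} (σ , σ-inj , σ-adj , H⇔) =
    finish (cycle⇒hamPath (tabulate σ) (Unique.tabulate⁺ σ-inj) (tabulate-cover σ σ-inj) (tabulate-cyclicEdge⇒adj σ σ-adj))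
    where
      finish : (∃ λ L → HamPath L × (∀ u w → CyclicEdge L u w ⇔ CyclicEdge (tabulate σ) u w)) →
               ∃ λ L → HamPath L × cycleMatrix L ≡ H
      finish (L , h , same) = L , h , cycleMatrix-≡ σ h same H⇔

  hamCycle-count : HasSize IsHamCycle (suc (suc k′) ! * ((suc k′ !) ^ m′ * suc (suc k′) !))
  hamCycle-count = HasSize-map cycleMatrix hamPath-count cycleMatrix-injective
    (λ H → mk⇔ hamCycle⇒hamPath (λ { (L , h , refl) → hamPath⇒hamCycle h }))

-- (k − 1)! is (k − 1) * (k − 2)! by definition of _!.
cycle-count-identity : ∀ c b p → (c * b) * (p * (c * b)) ≡ (c * (c * 1)) * (b * (b * p))
cycle-count-identity = solve 3 (λ c b p → (c :* b) :* (p :* (c :* b)) := (c :* (c :* con 1)) :* (b :* (b :* p))) refl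
  where open +-*-Solver

theorem1 : (k m : ℕ) → 3 ≤ k → 2 ≤ m →
    G.Regular k m k
    × HasSize (G.IsHamCycle k m) (((k ∸ 1) ^ 2) * (((k ∸ 2) !) ^ m))
theorem1 (suc (suc (suc k′))) (suc (suc m′)) (s≤s (s≤s (s≤s z≤n))) (s≤s (s≤s z≤n)) =
  regular , subst (HasSize IsHamCycle) (cycle-count-identity (suc (suc k′)) (suc k′ !) ((suc k′ !) ^ m′)) hamCycle-count
  where open Graph k′ m′
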